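{- Let $S_n$ be the star on $n\ge 2$ vertices and let $k\ge 2$ be an integer. Then the spectrum (multiset of eigenvalues, exponents denoting multiplicities) of the adjacency matrix of the power hypergraph $(S_n)^k$ is $$\{(-1)^{(n-1)(k-2)},\ (k-2)^{n-2},\ r^+,\ r^-\},$$ where $r^+$ and $r^-$ are the roots of $x^2-(k-2)x-(n-1)(k-1)=0$.
   Context: A hypergraph $\mathcal{H}=(V,E)$ consists of a finite vertex set $V$ and a set $E$ of edges, each a subset of $V$ of cardinality at least $2$. For $i\neq j$, $d(\{i,j\})$ is the number of edges containing both $i$ and $j$; the adjacency matrix has zero diagonal and $(i,j)$ entry $d(\{i,j\})$. The star $S_n$ is the graph on $n$ vertices with one central vertex adjacent to all $n-1$ others and no other edges. For a graph $\mathcal{G}$ and integer $k\ge2$, the power hypergraph $\mathcal{G}^k$ is the $k$-uniform hypergraph obtained by adding, for each edge $e\in E(\mathcal{G})$, $k-2$ new vertices $\varsigma_e=\{v^e_1,\dots,v^e_{k-2}\}$ (distinct for distinct edges) and taking as edges the sets $e\cup\varsigma_e$, $e\in E(\mathcal{G})$; its vertex set is $V(\mathcal{G})\cup\bigcup_e\varsigma_e$. -}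

module Defs where

open import Data.Nat as ℕ using (ℕ; zero; suc; _∸_; _≡ᵇ_; _≤ᵇ_; _<ᵇ_)
open import Data.Integer as ℤ using (ℤ; +_; _-_; _*_; _+_; -_)
open import Data.Fin using (Fin; toℕ; punchIn; _≟_) renaming (zero to fzero; suc to fsuc)
open import Data.Bool using (Bool; true; false; _∧_; _∨_; if_then_else_)
open import Data.List using (List; []; _∷_; length; filterᵇ; map; upTo; zip)
open import Relation.Nullary using (does)
open import Data.Product using (_×_; _,_)

record Hypergraph : Set where
  field
    V     : ℕ
    edges : List (Fin V → Bool)
open Hypergraph public

codeg : (H : Hypergraph) → Fin (V H) → Fin (V H) → ℕ
codeg H i j = length (filterᵇ (λ e → e i ∧ e j) (edges H))

Matrix : ℕ → Set
Matrix m = Fin m → Fin m → ℤ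

adjacency : (H : Hypergraph) → Matrix (V H)
adjacency H i j = if does (i ≟ j) then + 0 else + codeg H i j

-- Graphs: vertex set Fin n, edges given as a list of (unordered) pairs.

record Graph : Set where
  field
    nv : ℕ
    gedges : List (Fin nv × Fin nv)
open Graph public

star : ℕ → Graph
star zero    = record { nv = 0 ; gedges = [] }
star (suc m) = record { nv = suc m ; gedges = map (λ i → (fzero , fsuc i)) (allFin' m) }
  where
  allFin' : (m : ℕ) → List (Fin m)
  allFin' zero = []
  allFin' (suc m) = fzero ∷ map fsuc (allFin' m)

-- Power hypergraph G^k.  Vertices: the n vertices of G are 0,…,n-1;
-- the k-2 new vertices of the e-th edge (e = 0,1,…) are
-- n + e(k-2), …, n + (e+1)(k-2) - 1.
power : ℕ → Graph → Hypergraph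
power k G = record
  { V = n ℕ.+ length (gedges G) ℕ.* (k ∸ 2)
  ; edges = map mk (zip (upTo (length (gedges G))) (gedges G)) }
  where
  n = nv G
  mk : ℕ × (Fin n × Fin n) → Fin (n ℕ.+ length (gedges G) ℕ.* (k ∸ 2)) → Bool
  mk (e , (u , v)) w =
    (toℕ w ≡ᵇ toℕ u) ∨ (toℕ w ≡ᵇ toℕ v) ∨
    ((n ℕ.+ e ℕ.* (k ∸ 2) ≤ᵇ toℕ w) ∧ (toℕ w <ᵇ n ℕ.+ suc e ℕ.* (k ∸ 2)))

sumFin : (m : ℕ) → (Fin m → ℤ) → ℤ
sumFin zero    f = + 0
sumFin (suc m) f = f fzero + sumFin m (λ i → f (fsuc i))

sign : ℕ → ℤ
sign zero = + 1
sign (suc j) = - sign j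

det : (m : ℕ) → Matrix m → ℤ
det zero    M = + 1
det (suc m) M = sumFin (suc m) (λ j →
  sign (toℕ j) * M fzero j * det m (λ i l → M (fsuc i) (punchIn j l)))

charPoly : (m : ℕ) → Matrix m → ℤ → ℤ
charPoly m M x = det m (λ i j → (if does (i ≟ j) then x else + 0) - M i j)

-- Number the vertices as power does: the centre, the n - 1 leaves, then the k - 2 vertices
-- added to each edge.  In x I - A, subtracting from the column of every added vertex the column
-- of the leaf on its edge leaves x + 1 times the difference of two unit vectors; pulling these
-- factors out gives (x + 1) ^ ((n - 1) (k - 2)) times the determinant of a matrix whose block on
-- the added vertices is the identity.  Its Schur complement is the arrowhead matrix with corner x,
-- first row -1, first column -(k - 1) and diagonal x - (k - 2), whose determinant is
-- (x (x - (k - 2)) - (n - 1) (k - 1)) (x - (k - 2)) ^ (n - 2).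
module Submission where

open import Defs
open import Data.Nat using (ℕ; _≤_; _∸_)
import Data.Nat
open import Data.Nat as ℕ using (zero; suc; z≤n; s≤s; _≡ᵇ_; _≤ᵇ_; _<ᵇ_)
import Data.Nat.Properties as ℕP
open import Data.Integer using (ℤ; +_; -[1+_]; -_; _+_; _-_; _*_; _^_)
import Data.Integer.Properties as ℤP
open import Data.Integer.Tactic.RingSolver using (solve-∀)
open import Data.Fin as Fin using (Fin; toℕ; punchIn; punchOut; inject₁; _↑ˡ_; _↑ʳ_)
  renaming (zero to fzero; suc to fsuc)
import Data.Fin.Properties as FinP
import Data.Fin.Permutation as Perm
open import Data.Fin.Permutation.Components using (transpose)
open import Data.Bool using (Bool; true; false; _∧_; _∨_; if_then_else_)
import Data.Bool.Properties as BoolP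
open import Data.List using (List; []; _∷_; map; length; filterᵇ; zip; upTo; applyUpTo; foldr)
import Data.List.Properties as ListP
open import Data.Product as Prod using (_×_; _,_; ∃; ∃-syntax)
open import Data.Sum as Sum using (_⊎_; inj₁; inj₂)
open import Data.Empty using (⊥-elim)
open import Function using (_∘_; _⟨_⟩_; id)
open import Relation.Binary.PropositionalEquality
open import Relation.Binary.Definitions using (Tri; tri<; tri≈; tri>)
open import Relation.Nullary using (Dec; yes; no; does; ¬_)
open import Relation.Nullary.Decidable using (dec-true; dec-false)
open import Algebra.Properties.CommutativeMonoid.Sum ℤP.+-0-commutativeMonoid as Σ using ()
open import Algebra.Properties.CommutativeMonoid.Sum ℤP.*-1-commutativeMonoid
  using () renaming (sum to ∏; sum-remove to ∏-remove; sum-cong-≗ to ∏-cong)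

open ≡-Reasoning

-- Finite sums and products

sumFin-cong : ∀ N {f g : Fin N → ℤ} → (∀ j → f j ≡ g j) → sumFin N f ≡ sumFin N g
sumFin-cong zero    eq = refl
sumFin-cong (suc N) eq = cong₂ _+_ (eq fzero) (sumFin-cong N (eq ∘ fsuc))

sumFin-zero : ∀ N {f : Fin N → ℤ} → (∀ j → f j ≡ + 0) → sumFin N f ≡ + 0
sumFin-zero zero    eq = refl
sumFin-zero (suc N) eq = cong₂ _+_ (eq fzero) (sumFin-zero N (eq ∘ fsuc))

sumFin-+ : ∀ N (f g : Fin N → ℤ) → sumFin N (λ j → f j + g j) ≡ sumFin N f + sumFin N g
sumFin-+ zero    f g = refl
sumFin-+ (suc N) f g = begin
  f fzero + g fzero + sumFin N (λ j → f (fsuc j) + g (fsuc j))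
    ≡⟨ cong (_+_ (f fzero + g fzero)) (sumFin-+ N (f ∘ fsuc) (g ∘ fsuc)) ⟩
  f fzero + g fzero + (sumFin N (f ∘ fsuc) + sumFin N (g ∘ fsuc))
    ≡⟨ interchange (f fzero) (g fzero) _ _ ⟩
  f fzero + sumFin N (f ∘ fsuc) + (g fzero + sumFin N (g ∘ fsuc)) ∎
  where
  interchange : ∀ a b c d → a + b + (c + d) ≡ a + c + (b + d)
  interchange = solve-∀

sumFin-*ˡ : ∀ N a (f : Fin N → ℤ) → sumFin N (λ j → a * f j) ≡ a * sumFin N f
sumFin-*ˡ zero    a f = sym (ℤP.*-zeroʳ a)
sumFin-*ˡ (suc N) a f =
  cong (_+_ (a * f fzero)) (sumFin-*ˡ N a (f ∘ fsuc)) ⟨ trans ⟩ sym (ℤP.*-distribˡ-+ a _ _)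

sumFin-neg : ∀ N (f : Fin N → ℤ) → sumFin N (λ j → - f j) ≡ - sumFin N f
sumFin-neg zero    f = refl
sumFin-neg (suc N) f =
  cong (_+_ (- f fzero)) (sumFin-neg N (f ∘ fsuc)) ⟨ trans ⟩ sym (ℤP.neg-distrib-+ (f fzero) _)

sumFin-single : ∀ N (f : Fin N → ℤ) t → (∀ j → j ≢ t → f j ≡ + 0) → sumFin N f ≡ f t
sumFin-single (suc N) f fzero    off =
  cong (_+_ (f fzero)) (sumFin-zero N (λ j → off (fsuc j) (λ ()))) ⟨ trans ⟩ ℤP.+-identityʳ (f fzero)
sumFin-single (suc N) f (fsuc t) off =
  cong₂ _+_ (off fzero (λ ())) (sumFin-single N (f ∘ fsuc) t (λ j j≢t → off (fsuc j) (j≢t ∘ FinP.suc-injective)))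
  ⟨ trans ⟩ ℤP.+-identityˡ (f (fsuc t))

sumFin-↑ : ∀ a b (f : Fin (a ℕ.+ b) → ℤ) →
  sumFin (a ℕ.+ b) f ≡ sumFin a (λ i → f (i ↑ˡ b)) + sumFin b (λ i → f (a ↑ʳ i))
sumFin-↑ zero    b f = sym (ℤP.+-identityˡ _)
sumFin-↑ (suc a) b f =
  cong (_+_ (f fzero)) (sumFin-↑ a b (f ∘ fsuc)) ⟨ trans ⟩ sym (ℤP.+-assoc (f fzero) _ _)

sumFin-const : ∀ N x → sumFin N (λ _ → x) ≡ + N * x
sumFin-const zero    x = sym (ℤP.*-zeroˡ x)
sumFin-const (suc N) x = cong (_+_ x) (sumFin-const N x) ⟨ trans ⟩ sym (ℤP.suc-* (+ N) x)

sumFin-transpose : ∀ N (c d : Fin N) (f : Fin N → ℤ) → sumFin N (f ∘ transpose c d) ≡ sumFin N f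
sumFin-transpose N c d f =
  sumFin≡sum (f ∘ transpose c d) ⟨ trans ⟩ sym (Σ.∑-permute f (Perm.transpose c d)) ⟨ trans ⟩ sym (sumFin≡sum f)
  where
  sumFin≡sum : ∀ {N} (g : Fin N → ℤ) → sumFin N g ≡ Σ.sum g
  sumFin≡sum {zero}  g = refl
  sumFin≡sum {suc N} g = cong (_+_ (g fzero)) (sumFin≡sum (g ∘ fsuc))

∏-const : ∀ N d → ∏ {N} (λ _ → d) ≡ d ^ N
∏-const zero    d = refl
∏-const (suc N) d = cong (d *_) (∏-const N d)

∏-↑ : ∀ a b (f : Fin (a ℕ.+ b) → ℤ) → ∏ f ≡ ∏ (λ i → f (i ↑ˡ b)) * ∏ (λ i → f (a ↑ʳ i))
∏-↑ zero    b f = sym (ℤP.*-identityˡ _)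
∏-↑ (suc a) b f = cong (f fzero *_) (∏-↑ a b (f ∘ fsuc)) ⟨ trans ⟩ sym (ℤP.*-assoc (f fzero) _ _)

-- Multilinearity and alternation of det

minor : ∀ {N} → Fin (suc N) → Matrix (suc N) → Matrix N
minor j M i l = M (fsuc i) (punchIn j l)

term : ∀ {N} → Matrix (suc N) → Fin (suc N) → ℤ
term {N} M j = sign (toℕ j) * M fzero j * det N (minor j M)

det-cong : ∀ N {M M' : Matrix N} → (∀ i j → M i j ≡ M' i j) → det N M ≡ det N M'
det-cong zero    eq = refl
det-cong (suc N) eq = sumFin-cong (suc N) λ j →
  cong₂ (λ a b → sign (toℕ j) * a * b) (eq fzero j) (det-cong N (λ i l → eq (fsuc i) (punchIn j l)))

det-linearColumn : ∀ N (c : Fin N) {M A B : Matrix N} (a b : ℤ) →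
  (∀ i j → j ≢ c → A i j ≡ M i j) → (∀ i j → j ≢ c → B i j ≡ M i j) →
  (∀ i → M i c ≡ a * A i c + b * B i c) → det N M ≡ a * det N A + b * det N B
det-linearColumn (suc N) c {M} {A} {B} a b offA offB at-c = begin
  sumFin (suc N) (term M)                                      ≡⟨ sumFin-cong (suc N) term-linear ⟩
  sumFin (suc N) (λ j → a * term A j + b * term B j)           ≡⟨ sumFin-+ (suc N) (λ j → a * term A j) (λ j → b * term B j) ⟩
  sumFin (suc N) (λ j → a * term A j) + sumFin (suc N) (λ j → b * term B j)
    ≡⟨ cong₂ _+_ (sumFin-*ˡ (suc N) a (term A)) (sumFin-*ˡ (suc N) b (term B)) ⟩
  a * det (suc N) A + b * det (suc N) B                        ∎
  where
  -- the j = c summand is linear through its first-row entry, the others through their minor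
  term-linear : ∀ j → term M j ≡ a * term A j + b * term B j
  term-linear j with j Fin.≟ c
  ... | yes refl = begin
    sign (toℕ j) * M fzero j * det N (minor j M)
      ≡⟨ cong (λ z → sign (toℕ j) * z * det N (minor j M)) (at-c fzero) ⟩
    sign (toℕ j) * (a * A fzero j + b * B fzero j) * det N (minor j M)
      ≡⟨ distrib a b (sign (toℕ j)) (A fzero j) (B fzero j) (det N (minor j M)) ⟩
    a * (sign (toℕ j) * A fzero j * det N (minor j M)) + b * (sign (toℕ j) * B fzero j * det N (minor j M))
      ≡⟨ cong₂ (λ u v → a * (sign (toℕ j) * A fzero j * u) + b * (sign (toℕ j) * B fzero j * v))
           (det-cong N (λ i l → sym (offA (fsuc i) (punchIn j l) (FinP.punchInᵢ≢i j l))))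
           (det-cong N (λ i l → sym (offB (fsuc i) (punchIn j l) (FinP.punchInᵢ≢i j l)))) ⟩
    a * term A j + b * term B j ∎
    where
    distrib : ∀ a b s x y D → s * (a * x + b * y) * D ≡ a * (s * x * D) + b * (s * y * D)
    distrib = solve-∀
  ... | no j≢c = begin
    sign (toℕ j) * M fzero j * det N (minor j M)
      ≡⟨ cong (sign (toℕ j) * M fzero j *_) (det-linearColumn N c₀ a b
           (λ i l l≢c₀ → offA (fsuc i) (punchIn j l) (l≢c₀ ∘ punchIn≡c⇒≡c₀))
           (λ i l l≢c₀ → offB (fsuc i) (punchIn j l) (l≢c₀ ∘ punchIn≡c⇒≡c₀))
           (λ i → subst (λ z → M (fsuc i) z ≡ a * A (fsuc i) z + b * B (fsuc i) z)
                        (sym (FinP.punchIn-punchOut j≢c)) (at-c (fsuc i)))) ⟩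
    sign (toℕ j) * M fzero j * (a * det N (minor j A) + b * det N (minor j B))
      ≡⟨ distrib a b (sign (toℕ j)) (M fzero j) (det N (minor j A)) (det N (minor j B)) ⟩
    a * (sign (toℕ j) * M fzero j * det N (minor j A)) + b * (sign (toℕ j) * M fzero j * det N (minor j B))
      ≡⟨ cong₂ (λ u v → a * (sign (toℕ j) * u * det N (minor j A)) + b * (sign (toℕ j) * v * det N (minor j B)))
           (sym (offA fzero j j≢c)) (sym (offB fzero j j≢c)) ⟩
    a * term A j + b * term B j ∎
    where
    c₀ = punchOut j≢c
    punchIn≡c⇒≡c₀ : ∀ {l} → punchIn j l ≡ c → l ≡ c₀
    punchIn≡c⇒≡c₀ eq = FinP.punchIn-injective j _ c₀ (eq ⟨ trans ⟩ sym (FinP.punchIn-punchOut j≢c))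
    distrib : ∀ a b s x D E → s * x * (a * D + b * E) ≡ a * (s * x * D) + b * (s * x * E)
    distrib = solve-∀

det-zeroColumn : ∀ N (M : Matrix N) (c : Fin N) → (∀ i → M i c ≡ + 0) → det N M ≡ + 0
det-zeroColumn N M c zero-c =
  det-linearColumn N c (+ 0) (+ 0) (λ _ _ _ → refl) (λ _ _ _ → refl) (λ i → zero-c i ⟨ trans ⟩ sym (zero-combination (M i c)))
  ⟨ trans ⟩ zero-combination (det N M)
  where
  zero-combination : ∀ x → + 0 * x + + 0 * x ≡ + 0
  zero-combination = solve-∀

transpose-left : ∀ {n} (c d : Fin n) → transpose c d c ≡ d
transpose-left c d rewrite dec-true (c Fin.≟ c) refl = refl

transpose-right : ∀ {n} (c d : Fin n) → transpose c d d ≡ c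
transpose-right c d with d Fin.≟ c
... | yes d≡c = d≡c
... | no _ rewrite dec-true (d Fin.≟ d) refl = refl

transpose-other : ∀ {n} {c d l : Fin n} → l ≢ c → l ≢ d → transpose c d l ≡ l
transpose-other {c = c} {d} {l} l≢c l≢d rewrite dec-false (l Fin.≟ c) l≢c | dec-false (l Fin.≟ d) l≢d = refl

-- Case splits on l ≟ c are done through a helper taking the Dec: a `with` would also abstract
-- the identical test inside transpose and block its reduction.
transpose-involutive : ∀ {n} (c d l : Fin n) → transpose c d (transpose c d l) ≡ l
transpose-involutive c d l = by-cases (l Fin.≟ c) (l Fin.≟ d)
  where
  P : Fin _ → Set
  P z = transpose c d (transpose c d z) ≡ z
  by-cases : Dec (l ≡ c) → Dec (l ≡ d) → P l
  by-cases (yes l≡c) _ = subst P (sym l≡c) (cong (transpose c d) (transpose-left c d) ⟨ trans ⟩ transpose-right c d)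
  by-cases (no _) (yes l≡d) = subst P (sym l≡d) (cong (transpose c d) (transpose-right c d) ⟨ trans ⟩ transpose-left c d)
  by-cases (no l≢c) (no l≢d) = cong (transpose c d) (transpose-other l≢c l≢d) ⟨ trans ⟩ transpose-other l≢c l≢d

toℕ-punchIn-< : ∀ {n} (j : Fin (suc n)) (l : Fin n) → toℕ l ℕ.< toℕ j → toℕ (punchIn j l) ≡ toℕ l
toℕ-punchIn-< (fsuc j) fzero    _         = refl
toℕ-punchIn-< (fsuc j) (fsuc l) (s≤s l<j) = cong suc (toℕ-punchIn-< j l l<j)

toℕ-punchIn-≥ : ∀ {n} (j : Fin (suc n)) (l : Fin n) → toℕ j ℕ.≤ toℕ l → toℕ (punchIn j l) ≡ suc (toℕ l)
toℕ-punchIn-≥ fzero    l        _         = refl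
toℕ-punchIn-≥ (fsuc j) (fsuc l) (s≤s j≤l) = cong suc (toℕ-punchIn-≥ j l j≤l)

punchOut-adjacent : ∀ {n} {j c d : Fin (suc n)} (j≢c : j ≢ c) (j≢d : j ≢ d) →
  toℕ d ≡ suc (toℕ c) → toℕ (punchOut j≢d) ≡ suc (toℕ (punchOut j≢c))
punchOut-adjacent {j = fzero} {fzero} j≢c _ _ = ⊥-elim (j≢c refl)
punchOut-adjacent {j = fzero} {fsuc c} {fsuc d} _ _ adj = ℕP.suc-injective adj
punchOut-adjacent {suc n} {fsuc fzero}    {fzero} {fsuc fzero} _ j≢d _ = ⊥-elim (j≢d refl)
punchOut-adjacent {suc (suc n)} {fsuc (fsuc j)} {fzero} {fsuc fzero} _ _ _ = refl
punchOut-adjacent {suc n} {fsuc j} {fsuc c} {fsuc d} j≢c j≢d adj =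
  cong suc (punchOut-adjacent (j≢c ∘ cong fsuc) (j≢d ∘ cong fsuc) (ℕP.suc-injective adj))

toℕ-≢ : ∀ {n} {a b : Fin n} → toℕ a ≢ toℕ b → a ≢ b
toℕ-≢ ne = ne ∘ cong toℕ

transpose-punchIn : ∀ {n} {j c d : Fin (suc n)} (j≢c : j ≢ c) (j≢d : j ≢ d) (l : Fin n) →
  transpose c d (punchIn j l) ≡ punchIn j (transpose (punchOut j≢c) (punchOut j≢d) l)
transpose-punchIn {j = j} {c} {d} j≢c j≢d l = by-cases (l Fin.≟ c₀) (l Fin.≟ d₀)
  where
  c₀ = punchOut j≢c
  d₀ = punchOut j≢d
  P : Fin _ → Set
  P z = transpose c d (punchIn j z) ≡ punchIn j (transpose c₀ d₀ z)
  by-cases : Dec (l ≡ c₀) → Dec (l ≡ d₀) → P l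
  by-cases (yes l≡c₀) _ = subst P (sym l≡c₀) (begin
    transpose c d (punchIn j c₀) ≡⟨ cong (transpose c d) (FinP.punchIn-punchOut j≢c) ⟩
    transpose c d c              ≡⟨ transpose-left c d ⟩
    d                            ≡⟨ FinP.punchIn-punchOut j≢d ⟨
    punchIn j d₀                 ≡⟨ cong (punchIn j) (transpose-left c₀ d₀) ⟨
    punchIn j (transpose c₀ d₀ c₀) ∎)
  by-cases (no _) (yes l≡d₀) = subst P (sym l≡d₀) (begin
    transpose c d (punchIn j d₀) ≡⟨ cong (transpose c d) (FinP.punchIn-punchOut j≢d) ⟩
    transpose c d d              ≡⟨ transpose-right c d ⟩
    c                            ≡⟨ FinP.punchIn-punchOut j≢c ⟨
    punchIn j c₀                 ≡⟨ cong (punchIn j) (transpose-right c₀ d₀) ⟨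
    punchIn j (transpose c₀ d₀ d₀) ∎)
  by-cases (no l≢c₀) (no l≢d₀) =
    transpose-other (λ eq → l≢c₀ (FinP.punchIn-injective j l c₀ (eq ⟨ trans ⟩ sym (FinP.punchIn-punchOut j≢c))))
                    (λ eq → l≢d₀ (FinP.punchIn-injective j l d₀ (eq ⟨ trans ⟩ sym (FinP.punchIn-punchOut j≢d))))
    ⟨ trans ⟩ cong (punchIn j) (sym (transpose-other l≢c₀ l≢d₀))

transpose-punchIn-adjacent : ∀ {n} {c d : Fin (suc n)} (l : Fin n) → toℕ d ≡ suc (toℕ c) →
  transpose c d (punchIn c l) ≡ punchIn d l
transpose-punchIn-adjacent {c = c} {d} l adj = by-cmp (ℕP.<-cmp (toℕ l) (toℕ c))
  where
  c<d : toℕ c ℕ.< toℕ d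
  c<d = subst (toℕ c ℕ.<_) (sym adj) (ℕP.n<1+n (toℕ c))
  by-cmp : Tri (toℕ l ℕ.< toℕ c) (toℕ l ≡ toℕ c) (toℕ c ℕ.< toℕ l) → transpose c d (punchIn c l) ≡ punchIn d l
  by-cmp (tri< l<c _ _) =
    transpose-other (toℕ-≢ (ℕP.<⇒≢ (subst (ℕ._< toℕ c) (sym in-c) l<c)))
                    (toℕ-≢ (ℕP.<⇒≢ (subst (ℕ._< toℕ d) (sym in-c) (ℕP.<-trans l<c c<d))))
    ⟨ trans ⟩ FinP.toℕ-injective (in-c ⟨ trans ⟩ sym (toℕ-punchIn-< d l (ℕP.<-trans l<c c<d)))
    where
    in-c = toℕ-punchIn-< c l l<c
  by-cmp (tri≈ _ l≡c _) = cong (transpose c d) in-c≡d ⟨ trans ⟩ transpose-right c d ⟨ trans ⟩ sym in-d≡c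
    where
    in-c≡d : punchIn c l ≡ d
    in-c≡d = FinP.toℕ-injective (toℕ-punchIn-≥ c l (ℕP.≤-reflexive (sym l≡c)) ⟨ trans ⟩ cong suc l≡c ⟨ trans ⟩ sym adj)
    in-d≡c : punchIn d l ≡ c
    in-d≡c = FinP.toℕ-injective (toℕ-punchIn-< d l (subst (ℕ._< toℕ d) (sym l≡c) c<d) ⟨ trans ⟩ l≡c)
  by-cmp (tri> _ _ c<l) =
    transpose-other (toℕ-≢ (ℕP.>⇒≢ (subst (toℕ c ℕ.<_) (sym in-c) (ℕP.<-trans c<l (ℕP.n<1+n (toℕ l))))))
                    (toℕ-≢ (ℕP.>⇒≢ (subst₂ ℕ._<_ (sym adj) (sym in-c) (s≤s c<l))))
    ⟨ trans ⟩ FinP.toℕ-injective (in-c ⟨ trans ⟩ sym (toℕ-punchIn-≥ d l (subst (ℕ._≤ toℕ l) (sym adj) c<l)))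
    where
    in-c = toℕ-punchIn-≥ c l (ℕP.<⇒≤ c<l)

swapColumns : ∀ {N} → Fin N → Fin N → Matrix N → Matrix N
swapColumns c d M i l = M i (transpose c d l)

det-swapAdjacentColumns : ∀ N (M : Matrix N) (c d : Fin N) → toℕ d ≡ suc (toℕ c) →
  det N (swapColumns c d M) ≡ - det N M
det-swapAdjacentColumns (suc N) M c d adj = begin
  sumFin (suc N) (term M')                             ≡⟨ sumFin-cong (suc N) term-swap ⟩
  sumFin (suc N) (λ j → - term M (transpose c d j))    ≡⟨ sumFin-neg (suc N) (term M ∘ transpose c d) ⟩
  - sumFin (suc N) (term M ∘ transpose c d)            ≡⟨ cong -_ (sumFin-transpose (suc N) c d (term M)) ⟩
  - det (suc N) M                                      ∎
  where
  M' = swapColumns c d M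
  minor-c : ∀ i l → minor c M' i l ≡ minor d M i l
  minor-c i l = cong (M (fsuc i)) (transpose-punchIn-adjacent l adj)
  minor-d : ∀ i l → minor d M' i l ≡ minor c M i l
  minor-d i l = cong (M (fsuc i)) (begin
    transpose c d (punchIn d l)                         ≡⟨ cong (transpose c d) (transpose-punchIn-adjacent l adj) ⟨
    transpose c d (transpose c d (punchIn c l))         ≡⟨ transpose-involutive c d (punchIn c l) ⟩
    punchIn c l                                         ∎)
  negate : ∀ s x D → - s * x * D ≡ - (s * x * D)
  negate = solve-∀
  double-negate : ∀ s x D → s * x * D ≡ - (- s * x * D)
  double-negate = solve-∀
  term-swap-c : term M' c ≡ - term M (transpose c d c)
  term-swap-c = begin
    sign (toℕ c) * M fzero (transpose c d c) * det N (minor c M')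
      ≡⟨ cong₂ (λ x D → sign (toℕ c) * M fzero x * D) (transpose-left c d) (det-cong N minor-c) ⟩
    sign (toℕ c) * M fzero d * det N (minor d M)
      ≡⟨ double-negate (sign (toℕ c)) (M fzero d) (det N (minor d M)) ⟩
    - (sign (suc (toℕ c)) * M fzero d * det N (minor d M))
      ≡⟨ cong (λ z → - (sign z * M fzero d * det N (minor d M))) adj ⟨
    - term M d
      ≡⟨ cong (λ z → - term M z) (transpose-left c d) ⟨
    - term M (transpose c d c) ∎
  term-swap-d : term M' d ≡ - term M (transpose c d d)
  term-swap-d = begin
    sign (toℕ d) * M fzero (transpose c d d) * det N (minor d M')
      ≡⟨ cong₂ (λ x D → sign (toℕ d) * M fzero x * D) (transpose-right c d) (det-cong N minor-d) ⟩
    sign (toℕ d) * M fzero c * det N (minor c M)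
      ≡⟨ cong (λ z → sign z * M fzero c * det N (minor c M)) adj ⟩
    - sign (toℕ c) * M fzero c * det N (minor c M)
      ≡⟨ negate (sign (toℕ c)) (M fzero c) (det N (minor c M)) ⟩
    - term M c
      ≡⟨ cong (λ z → - term M z) (transpose-right c d) ⟨
    - term M (transpose c d d) ∎
  term-swap-other : ∀ {j} → j ≢ c → j ≢ d → term M' j ≡ - term M (transpose c d j)
  term-swap-other {j} j≢c j≢d = begin
    sign (toℕ j) * M fzero (transpose c d j) * det N (minor j M')
      ≡⟨ cong₂ (λ x D → sign (toℕ j) * M fzero x * D) (transpose-other j≢c j≢d)
           (det-cong N (λ i l → cong (M (fsuc i)) (transpose-punchIn j≢c j≢d l))) ⟩
    sign (toℕ j) * M fzero j * det N (swapColumns (punchOut j≢c) (punchOut j≢d) (minor j M))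
      ≡⟨ cong (sign (toℕ j) * M fzero j *_)
           (det-swapAdjacentColumns N (minor j M) _ _ (punchOut-adjacent j≢c j≢d adj)) ⟩
    sign (toℕ j) * M fzero j * - det N (minor j M)
      ≡⟨ ℤP.neg-distribʳ-* (sign (toℕ j) * M fzero j) (det N (minor j M)) ⟨
    - term M j
      ≡⟨ cong (λ z → - term M z) (transpose-other j≢c j≢d) ⟨
    - term M (transpose c d j) ∎
  term-swap : ∀ j → term M' j ≡ - term M (transpose c d j)
  term-swap j = by-cases (j Fin.≟ c) (j Fin.≟ d)
    where
    by-cases : Dec (j ≡ c) → Dec (j ≡ d) → term M' j ≡ - term M (transpose c d j)
    by-cases (yes refl) _        = term-swap-c
    by-cases (no _)     (yes refl) = term-swap-d
    by-cases (no j≢c)   (no j≢d) = term-swap-other j≢c j≢d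

i≡-i⇒i≡0 : ∀ i → i ≡ - i → i ≡ + 0
i≡-i⇒i≡0 (+ zero)  _ = refl
i≡-i⇒i≡0 (+ suc n) ()
i≡-i⇒i≡0 -[1+ n ]  ()

det-equalAdjacentColumns : ∀ N (M : Matrix N) (c d : Fin N) → toℕ d ≡ suc (toℕ c) →
  (∀ i → M i c ≡ M i d) → det N M ≡ + 0
det-equalAdjacentColumns N M c d adj eq =
  i≡-i⇒i≡0 (det N M) (det-cong N unchanged ⟨ trans ⟩ det-swapAdjacentColumns N M c d adj)
  where
  unchanged : ∀ i l → M i l ≡ swapColumns c d M i l
  unchanged i l = by-cases (l Fin.≟ c) (l Fin.≟ d)
    where
    P : Fin N → Set
    P z = M i z ≡ M i (transpose c d z)
    by-cases : Dec (l ≡ c) → Dec (l ≡ d) → P l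
    by-cases (yes l≡c) _ = subst P (sym l≡c) (eq i ⟨ trans ⟩ cong (M i) (sym (transpose-left c d)))
    by-cases (no _) (yes l≡d) = subst P (sym l≡d) (sym (eq i) ⟨ trans ⟩ cong (M i) (sym (transpose-right c d)))
    by-cases (no l≢c) (no l≢d) = cong (M i) (sym (transpose-other l≢c l≢d))

-- column b moves leftwards, one adjacent swap at a time, until it is next to column a
det-equalColumns-< : ∀ {N} k (M : Matrix N) (a b : Fin N) → toℕ b ≡ k → toℕ a ℕ.< k →
  (∀ i → M i a ≡ M i b) → det N M ≡ + 0
det-equalColumns-< (suc k) M a (fsuc b₀) b≡k (s≤s a≤k) eq with toℕ a ℕ.≟ k
... | yes a≡k = det-equalAdjacentColumns _ M a (fsuc b₀) (b≡k ⟨ trans ⟩ cong suc (sym a≡k)) eq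
... | no a≢k = begin
  det _ M                 ≡⟨ ℤP.neg-involutive (det _ M) ⟨
  - - det _ M             ≡⟨ cong -_ (det-swapAdjacentColumns _ M b′ b b′-adjacent) ⟨
  - det _ (swapColumns b′ b M)
    ≡⟨ cong -_ (det-equalColumns-< k (swapColumns b′ b M) a b′ b′≡k a<k swapped-eq) ⟩
  - + 0                   ∎
  where
  b = fsuc b₀
  b′ = inject₁ b₀
  b′≡k : toℕ b′ ≡ k
  b′≡k = FinP.toℕ-inject₁ b₀ ⟨ trans ⟩ ℕP.suc-injective b≡k
  b′-adjacent : toℕ b ≡ suc (toℕ b′)
  b′-adjacent = cong suc (sym (FinP.toℕ-inject₁ b₀))
  a<k : toℕ a ℕ.< k
  a<k = ℕP.≤∧≢⇒< a≤k a≢k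
  a<b′ : toℕ a ℕ.< toℕ b′
  a<b′ = subst (toℕ a ℕ.<_) (sym b′≡k) a<k
  swapped-eq : ∀ i → swapColumns b′ b M i a ≡ swapColumns b′ b M i b′
  swapped-eq i = begin
    M i (transpose b′ b a) ≡⟨ cong (M i) (transpose-other (toℕ-≢ (ℕP.<⇒≢ a<b′)) (toℕ-≢ (ℕP.<⇒≢ a<b))) ⟩
    M i a                  ≡⟨ eq i ⟩
    M i b                  ≡⟨ cong (M i) (transpose-left b′ b) ⟨
    M i (transpose b′ b b′) ∎
    where
    a<b : toℕ a ℕ.< toℕ b
    a<b = ℕP.<-trans a<b′ (subst (toℕ b′ ℕ.<_) (sym b′-adjacent) (ℕP.n<1+n _))

det-equalColumns : ∀ N (M : Matrix N) {a b : Fin N} → a ≢ b → (∀ i → M i a ≡ M i b) → det N M ≡ + 0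
det-equalColumns N M {a} {b} a≢b eq with ℕP.<-cmp (toℕ a) (toℕ b)
... | tri< a<b _ _ = det-equalColumns-< (toℕ b) M a b refl a<b eq
... | tri≈ _ a≡b _ = ⊥-elim (a≢b (FinP.toℕ-injective a≡b))
... | tri> _ _ b<a = det-equalColumns-< (toℕ a) M b a refl b<a (sym ∘ eq)

-- Column operations and special shapes

setColumn : ∀ {N} → Matrix N → Fin N → (Fin N → ℤ) → Matrix N
setColumn M c v i j = if does (j Fin.≟ c) then v i else M i j

setColumn-≡ : ∀ {N} (M : Matrix N) c v i → setColumn M c v i c ≡ v i
setColumn-≡ M c v i rewrite dec-true (c Fin.≟ c) refl = refl

setColumn-≢ : ∀ {N} (M : Matrix N) {c j} v i → j ≢ c → setColumn M c v i j ≡ M i j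
setColumn-≢ M {c} {j} v i j≢c rewrite dec-false (j Fin.≟ c) j≢c = refl

det-setColumn-linear : ∀ N (M : Matrix N) c {w} (u v : Fin N → ℤ) a b → (∀ i → w i ≡ a * u i + b * v i) →
  det N (setColumn M c w) ≡ a * det N (setColumn M c u) + b * det N (setColumn M c v)
det-setColumn-linear N M c {w} u v a b w≡ = det-linearColumn N c a b
  (λ i j j≢c → setColumn-≢ M u i j≢c ⟨ trans ⟩ sym (setColumn-≢ M w i j≢c))
  (λ i j j≢c → setColumn-≢ M v i j≢c ⟨ trans ⟩ sym (setColumn-≢ M w i j≢c))
  (λ i → setColumn-≡ M c w i ⟨ trans ⟩ w≡ i ⟨ trans ⟩
         sym (cong₂ (λ x y → a * x + b * y) (setColumn-≡ M c u i) (setColumn-≡ M c v i)))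

det-setColumn-+ : ∀ N (M : Matrix N) c (u v : Fin N → ℤ) →
  det N (setColumn M c (λ i → u i + v i)) ≡ det N (setColumn M c u) + det N (setColumn M c v)
det-setColumn-+ N M c u v =
  det-setColumn-linear N M c u v (+ 1) (+ 1) (λ i → sym (cong₂ _+_ (ℤP.*-identityˡ (u i)) (ℤP.*-identityˡ (v i))))
  ⟨ trans ⟩ cong₂ _+_ (ℤP.*-identityˡ (det N (setColumn M c u))) (ℤP.*-identityˡ (det N (setColumn M c v)))

det-setColumn-*ˡ : ∀ N (M : Matrix N) c a (u : Fin N → ℤ) →
  det N (setColumn M c (λ i → a * u i)) ≡ a * det N (setColumn M c u)
det-setColumn-*ˡ N M c a u =
  det-setColumn-linear N M c u u a (+ 0) (λ i → sym (+0-right a (u i))) ⟨ trans ⟩ +0-right a (det N (setColumn M c u))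
  where
  +0-right : ∀ a x → a * x + + 0 * x ≡ a * x
  +0-right = solve-∀

det-setColumn-sum : ∀ N K (M : Matrix N) c (h : Fin K → Fin N → ℤ) →
  det N (setColumn M c (λ i → sumFin K (λ t → h t i))) ≡ sumFin K (λ t → det N (setColumn M c (h t)))
det-setColumn-sum N zero    M c h = det-zeroColumn N _ c (setColumn-≡ M c _)
det-setColumn-sum N (suc K) M c h =
  det-setColumn-+ N M c (h fzero) (λ i → sumFin K (λ t → h (fsuc t) i))
  ⟨ trans ⟩ cong (_+_ (det N (setColumn M c (h fzero)))) (det-setColumn-sum N K M c (h ∘ fsuc))

det-addColumnCombination : ∀ N (M : Matrix N) (c : Fin N) (w : Fin N → ℤ) → w c ≡ + 0 →
  det N (setColumn M c (λ i → M i c + sumFin N (λ s → w s * M i s))) ≡ det N M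
det-addColumnCombination N M c w w-c≡0 = begin
  det N (setColumn M c (λ i → M i c + sumFin N (λ s → w s * M i s)))
    ≡⟨ det-setColumn-+ N M c (λ i → M i c) (λ i → sumFin N (λ s → w s * M i s)) ⟩
  det N (setColumn M c (λ i → M i c)) + det N (setColumn M c (λ i → sumFin N (λ s → w s * M i s)))
    ≡⟨ cong₂ _+_ (det-cong N unchanged)
                 (det-setColumn-sum N N M c (λ s i → w s * M i s) ⟨ trans ⟩ sumFin-zero N multiple-zero) ⟩
  det N M + + 0
    ≡⟨ ℤP.+-identityʳ (det N M) ⟩
  det N M ∎
  where
  unchanged : ∀ i j → setColumn M c (λ i → M i c) i j ≡ M i j
  unchanged i j with j Fin.≟ c
  ... | yes refl = refl
  ... | no _     = refl
  multiple-zero : ∀ s → det N (setColumn M c (λ i → w s * M i s)) ≡ + 0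
  multiple-zero s = det-setColumn-*ˡ N M c (w s) (λ i → M i s) ⟨ trans ⟩ by-cases (s Fin.≟ c)
    where
    by-cases : Dec (s ≡ c) → w s * det N (setColumn M c (λ i → M i s)) ≡ + 0
    by-cases (yes refl) = cong (_* det N (setColumn M c (λ i → M i s))) w-c≡0
    by-cases (no s≢c)   = cong (w s *_) (det-equalColumns N _ (s≢c ∘ sym)
      (λ i → setColumn-≡ M c col-s i ⟨ trans ⟩ sym (setColumn-≢ M col-s i s≢c))) ⟨ trans ⟩ ℤP.*-zeroʳ (w s)
      where
      col-s : Fin N → ℤ
      col-s i = M i s

det-addColumnCombinations : ∀ N (M M' : Matrix N) (W : Fin N → Fin N → ℤ) →
  (∀ c s → W c s ≡ + 0 ⊎ (∀ u → W s u ≡ + 0)) →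
  (∀ i c → M' i c ≡ M i c + sumFin N (λ s → W c s * M i s)) → det N M' ≡ det N M
det-addColumnCombinations N M M' W sources-unmodified M'≡ =
  det-cong N (λ i c → sym (partial-< N i c (FinP.toℕ<n c))) ⟨ trans ⟩ modify-first N ℕP.≤-refl
  where
  partial : ℕ → Matrix N
  partial t i c = if does (toℕ c ℕ.<? t) then M' i c else M i c
  partial-< : ∀ t i c → toℕ c ℕ.< t → partial t i c ≡ M' i c
  partial-< t i c c<t rewrite dec-true (toℕ c ℕ.<? t) c<t = refl
  partial-≮ : ∀ t i c → ¬ toℕ c ℕ.< t → partial t i c ≡ M i c
  partial-≮ t i c c≮t rewrite dec-false (toℕ c ℕ.<? t) c≮t = refl
  source-unmodified : ∀ i s → (∀ u → W s u ≡ + 0) → M' i s ≡ M i s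
  source-unmodified i s W-s≡0 = begin
    M' i s                                   ≡⟨ M'≡ i s ⟩
    M i s + sumFin N (λ u → W s u * M i u)   ≡⟨ cong (_+_ (M i s)) (sumFin-zero N (λ u → cong (_* M i u) (W-s≡0 u))) ⟩
    M i s + + 0                              ≡⟨ ℤP.+-identityʳ (M i s) ⟩
    M i s                                    ∎
  weighted : ∀ t i c s → W c s * partial t i s ≡ W c s * M i s
  weighted t i c s with sources-unmodified c s | toℕ s ℕ.<? t
  ... | inj₁ W≡0       | _       rewrite W≡0 = refl
  ... | inj₂ unmodified | yes s<t = cong (W c s *_) (partial-< t i s s<t ⟨ trans ⟩ source-unmodified i s unmodified)
  ... | inj₂ _          | no s≮t  = cong (W c s *_) (partial-≮ t i s s≮t)
  modify-next : ∀ t → t ℕ.< N → det N (partial (suc t)) ≡ det N (partial t)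
  modify-next t t<N =
    det-cong N next ⟨ trans ⟩ det-addColumnCombination N (partial t) c (W c) W-c-c
    where
    c = Fin.fromℕ< t<N
    c≡t : toℕ c ≡ t
    c≡t = FinP.toℕ-fromℕ< t<N
    W-c-c : W c c ≡ + 0
    W-c-c with sources-unmodified c c
    ... | inj₁ W≡0 = W≡0
    ... | inj₂ unmodified = unmodified c
    next : ∀ i j → partial (suc t) i j ≡
           setColumn (partial t) c (λ i → partial t i c + sumFin N (λ s → W c s * partial t i s)) i j
    next i j with j Fin.≟ c
    ... | yes refl = begin
      partial (suc t) i j                               ≡⟨ partial-< (suc t) i j (ℕP.≤-reflexive (cong suc c≡t)) ⟩
      M' i j                                            ≡⟨ M'≡ i j ⟩
      M i j + sumFin N (λ s → W j s * M i s)
        ≡⟨ cong₂ _+_ (sym (partial-≮ t i j (ℕP.<-irrefl c≡t))) (sumFin-cong N (λ s → sym (weighted t i j s))) ⟩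
      partial t i j + sumFin N (λ s → W j s * partial t i s) ∎
    ... | no j≢c with toℕ j ℕ.<? t
    ...   | yes j<t = partial-< (suc t) i j (ℕP.m<n⇒m<1+n j<t) ⟨ trans ⟩ sym (partial-< t i j j<t)
    ...   | no j≮t  = partial-≮ (suc t) i j j≮1+t ⟨ trans ⟩ sym (partial-≮ t i j j≮t)
      where
      j≮1+t : ¬ toℕ j ℕ.< suc t
      j≮1+t j<1+t = j≢c (FinP.toℕ-injective (ℕP.≤-antisym (ℕP.≤-pred j<1+t) (ℕP.≮⇒≥ j≮t) ⟨ trans ⟩ sym c≡t))
  modify-first : ∀ t → t ℕ.≤ N → det N (partial t) ≡ det N M
  modify-first zero    _   = det-cong N (λ i c → partial-≮ zero i c (λ ()))
  modify-first (suc t) t<N = modify-next t t<N ⟨ trans ⟩ modify-first t (ℕP.<⇒≤ t<N)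

term-zero : ∀ {N} (M : Matrix (suc N)) j → M fzero j ≡ + 0 → term M j ≡ + 0
term-zero {N} M j M-0j≡0 = begin
  sign (toℕ j) * M fzero j * det N (minor j M) ≡⟨ cong (λ z → sign (toℕ j) * z * det N (minor j M)) M-0j≡0 ⟩
  sign (toℕ j) * + 0 * det N (minor j M)       ≡⟨ cong (_* det N (minor j M)) (ℤP.*-zeroʳ (sign (toℕ j))) ⟩
  + 0 * det N (minor j M)                      ≡⟨ ℤP.*-zeroˡ (det N (minor j M)) ⟩
  + 0                                          ∎

det-scaleColumns : ∀ N (M : Matrix N) (f : Fin N → ℤ) → det N (λ i c → f c * M i c) ≡ ∏ f * det N M
det-scaleColumns zero    M f = refl
det-scaleColumns (suc N) M f = begin
  sumFin (suc N) (term (λ i c → f c * M i c))  ≡⟨ sumFin-cong (suc N) term-scaled ⟩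
  sumFin (suc N) (λ j → ∏ f * term M j)        ≡⟨ sumFin-*ˡ (suc N) (∏ f) (term M) ⟩
  ∏ f * det (suc N) M                          ∎
  where
  rearrange : ∀ s x y P D → s * (x * y) * (P * D) ≡ (x * P) * (s * y * D)
  rearrange = solve-∀
  term-scaled : ∀ j → term (λ i c → f c * M i c) j ≡ ∏ f * term M j
  term-scaled j = begin
    sign (toℕ j) * (f j * M fzero j) * det N (λ i l → f (punchIn j l) * minor j M i l)
      ≡⟨ cong (sign (toℕ j) * (f j * M fzero j) *_) (det-scaleColumns N (minor j M) (f ∘ punchIn j)) ⟩
    sign (toℕ j) * (f j * M fzero j) * (∏ (f ∘ punchIn j) * det N (minor j M))
      ≡⟨ rearrange (sign (toℕ j)) (f j) (M fzero j) (∏ (f ∘ punchIn j)) (det N (minor j M)) ⟩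
    f j * ∏ (f ∘ punchIn j) * term M j
      ≡⟨ cong (_* term M j) (∏-remove {i = j} f) ⟨
    ∏ f * term M j ∎

det-diagonal : ∀ N (M : Matrix N) d → (∀ i j → i ≢ j → M i j ≡ + 0) → (∀ i → M i i ≡ d) → det N M ≡ d ^ N
det-diagonal zero    M d off on = refl
det-diagonal (suc N) M d off on = begin
  + 1 * M fzero fzero * det N (minor fzero M) + sumFin N (λ j → term M (fsuc j))
    ≡⟨ cong₂ _+_ (cong₂ (λ x D → + 1 * x * D) (on fzero) minor-diagonal)
                 (sumFin-zero N (λ j → term-zero M (fsuc j) (off fzero (fsuc j) (λ ())))) ⟩
  + 1 * d * d ^ N + + 0
    ≡⟨ ℤP.+-identityʳ _ ⟨ trans ⟩ cong (_* d ^ N) (ℤP.*-identityˡ d) ⟩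
  d ^ suc N ∎
  where
  minor-diagonal : det N (minor fzero M) ≡ d ^ N
  minor-diagonal = det-diagonal N (minor fzero M) d (λ i j i≢j → off (fsuc i) (fsuc j) (i≢j ∘ FinP.suc-injective)) (on ∘ fsuc)

toℕ-punchIn-≤ : ∀ {n} (j : Fin (suc n)) (l : Fin n) → toℕ (punchIn j l) ℕ.≤ suc (toℕ l)
toℕ-punchIn-≤ fzero    l        = ℕP.≤-refl
toℕ-punchIn-≤ (fsuc j) fzero    = z≤n
toℕ-punchIn-≤ (fsuc j) (fsuc l) = s≤s (toℕ-punchIn-≤ j l)

punchIn-↑ˡ : ∀ {r} q (j : Fin (suc r)) (l : Fin r) → punchIn (j ↑ˡ q) (l ↑ˡ q) ≡ punchIn j l ↑ˡ q
punchIn-↑ˡ q fzero    l        = refl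
punchIn-↑ˡ q (fsuc j) fzero    = refl
punchIn-↑ˡ q (fsuc j) (fsuc l) = cong fsuc (punchIn-↑ˡ q j l)

punchIn-↑ʳ : ∀ r {q} (j : Fin (suc r)) (l : Fin q) → punchIn (j ↑ˡ q) (r ↑ʳ l) ≡ suc r ↑ʳ l
punchIn-↑ʳ r {q} j l = FinP.toℕ-injective (begin
  toℕ (punchIn (j ↑ˡ q) (r ↑ʳ l)) ≡⟨ toℕ-punchIn-≥ (j ↑ˡ q) (r ↑ʳ l) j≤l ⟩
  suc (toℕ (r ↑ʳ l))              ≡⟨ cong suc (FinP.toℕ-↑ʳ r l) ⟩
  suc (r ℕ.+ toℕ l)               ≡⟨ FinP.toℕ-↑ʳ (suc r) l ⟨
  toℕ (suc r ↑ʳ l)                ∎)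
  where
  j≤l : toℕ (j ↑ˡ q) ℕ.≤ toℕ (r ↑ʳ l)
  j≤l = subst₂ ℕ._≤_ (sym (FinP.toℕ-↑ˡ j q)) (sym (FinP.toℕ-↑ʳ r l))
               (ℕP.≤-trans (ℕP.≤-pred (FinP.toℕ<n j)) (ℕP.m≤m+n r (toℕ l)))

↑ʳ-of-≥ : ∀ r {q} (i : Fin (r ℕ.+ q)) → r ℕ.≤ toℕ i → ∃ λ s → i ≡ r ↑ʳ s
↑ʳ-of-≥ zero    i        _         = i , refl
↑ʳ-of-≥ (suc r) (fsuc i) (s≤s r≤i) with ↑ʳ-of-≥ r i r≤i
... | s , refl = s , refl

↑ˡ-of-< : ∀ r q (j : Fin (r ℕ.+ q)) → toℕ j ℕ.< r → ∃ λ k → j ≡ k ↑ˡ q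
↑ˡ-of-< (suc r) q fzero    _         = fzero , refl
↑ˡ-of-< (suc r) q (fsuc j) (s≤s j<r) with ↑ˡ-of-< r q j j<r
... | k , refl = fsuc k , refl

-- the first r + 1 columns are supported on r rows, hence linearly dependent
det-wideZeroBlock : ∀ r q (F : Matrix (r ℕ.+ suc q)) →
  (∀ i j → r ℕ.≤ toℕ i → toℕ j ℕ.≤ r → F i j ≡ + 0) → det (r ℕ.+ suc q) F ≡ + 0
det-wideZeroBlock zero    q F zero-block = det-zeroColumn (suc q) F fzero (λ i → zero-block i fzero z≤n z≤n)
det-wideZeroBlock (suc r) q F zero-block = sumFin-zero (suc (r ℕ.+ suc q)) λ j →
  cong (sign (toℕ j) * F fzero j *_)
       (det-wideZeroBlock r q (minor j F) (λ i l r≤i l≤r →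
          zero-block (fsuc i) (punchIn j l) (s≤s r≤i) (ℕP.≤-trans (toℕ-punchIn-≤ j l) (s≤s l≤r))))
  ⟨ trans ⟩ ℤP.*-zeroʳ (sign (toℕ j) * F fzero j)

det-blockUpperTriangular : ∀ r q (F : Matrix (r ℕ.+ q)) → (∀ i j → F (r ↑ʳ i) (j ↑ˡ q) ≡ + 0) →
  det (r ℕ.+ q) F ≡ det r (λ i j → F (i ↑ˡ q) (j ↑ˡ q)) * det q (λ i j → F (r ↑ʳ i) (r ↑ʳ j))
det-blockUpperTriangular zero    q F _          = sym (ℤP.*-identityˡ _)
det-blockUpperTriangular (suc r) q F zero-block = begin
  det (suc r ℕ.+ q) F
    ≡⟨ sumFin-↑ (suc r) q (term F) ⟩
  sumFin (suc r) (λ j → term F (j ↑ˡ q)) + sumFin q (λ t → term F (suc r ↑ʳ t))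
    ≡⟨ cong₂ _+_ (sumFin-cong (suc r) left-term) (right-terms-zero q F zero-block) ⟩
  sumFin (suc r) (λ j → det q D * term A j) + + 0
    ≡⟨ ℤP.+-identityʳ _ ⟨ trans ⟩ sumFin-*ˡ (suc r) (det q D) (term A) ⟨ trans ⟩ ℤP.*-comm (det q D) (det (suc r) A) ⟩
  det (suc r) A * det q D ∎
  where
  A : Matrix (suc r)
  A i j = F (i ↑ˡ q) (j ↑ˡ q)
  D : Matrix q
  D i j = F (suc r ↑ʳ i) (suc r ↑ʳ j)
  rearrange : ∀ s x X Y → s * x * (X * Y) ≡ Y * (s * x * X)
  rearrange = solve-∀
  left-term : ∀ j → term F (j ↑ˡ q) ≡ det q D * term A j
  left-term j = begin
    sign (toℕ (j ↑ˡ q)) * A fzero j * det (r ℕ.+ q) (minor (j ↑ˡ q) F)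
      ≡⟨ cong₂ (λ n X → sign n * A fzero j * X) (FinP.toℕ-↑ˡ j q)
           (det-blockUpperTriangular r q (minor (j ↑ˡ q) F)
              (λ i l → cong (F (suc r ↑ʳ i)) (punchIn-↑ˡ q j l) ⟨ trans ⟩ zero-block i (punchIn j l))) ⟩
    sign (toℕ j) * A fzero j * (det r (λ i l → F (fsuc (i ↑ˡ q)) (punchIn (j ↑ˡ q) (l ↑ˡ q)))
                                * det q (λ i l → F (suc r ↑ʳ i) (punchIn (j ↑ˡ q) (r ↑ʳ l))))
      ≡⟨ cong₂ (λ X Y → sign (toℕ j) * A fzero j * (X * Y))
           (det-cong r (λ i l → cong (F (fsuc (i ↑ˡ q))) (punchIn-↑ˡ q j l)))
           (det-cong q (λ i l → cong (F (suc r ↑ʳ i)) (punchIn-↑ʳ r j l))) ⟩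
    sign (toℕ j) * A fzero j * (det r (minor j A) * det q D)
      ≡⟨ rearrange (sign (toℕ j)) (A fzero j) (det r (minor j A)) (det q D) ⟩
    det q D * term A j ∎
  right-terms-zero : ∀ q (F : Matrix (suc r ℕ.+ q)) → (∀ i j → F (suc r ↑ʳ i) (j ↑ˡ q) ≡ + 0) →
    sumFin q (λ t → term F (suc r ↑ʳ t)) ≡ + 0
  right-terms-zero zero     F _          = refl
  right-terms-zero (suc q′) F zero-block = sumFin-zero (suc q′) λ t →
    cong (sign (toℕ (suc r ↑ʳ t)) * F fzero (suc r ↑ʳ t) *_)
      (det-wideZeroBlock r q′ (minor (suc r ↑ʳ t) F) (minor-zero t))
    ⟨ trans ⟩ ℤP.*-zeroʳ (sign (toℕ (suc r ↑ʳ t)) * F fzero (suc r ↑ʳ t))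
    where
    minor-zero : ∀ t i l → r ℕ.≤ toℕ i → toℕ l ℕ.≤ r → minor (suc r ↑ʳ t) F i l ≡ + 0
    minor-zero t i l r≤i l≤r with ↑ʳ-of-≥ (suc r) (fsuc i) (s≤s r≤i) | ↑ˡ-of-< (suc r) (suc q′) (punchIn (suc r ↑ʳ t) l) column<
      where
      column< : toℕ (punchIn (suc r ↑ʳ t) l) ℕ.< suc r
      column< = subst (ℕ._< suc r) (sym (toℕ-punchIn-< (suc r ↑ʳ t) l l<t)) (s≤s l≤r)
        where
        l<t : toℕ l ℕ.< toℕ (suc r ↑ʳ t)
        l<t = subst (toℕ l ℕ.<_) (sym (FinP.toℕ-↑ʳ (suc r) t)) (ℕP.≤-trans (s≤s l≤r) (ℕP.m≤m+n (suc r) (toℕ t)))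
    ... | s , row≡ | k , column≡ = cong₂ F row≡ column≡ ⟨ trans ⟩ zero-block s k

-- Subtracting from the left columns the combination of right columns that clears the
-- lower-left block C leaves A - B C in the upper-left block.
det-schurComplement : ∀ r q (M : Matrix (r ℕ.+ q)) →
  (∀ s t → s ≢ t → M (r ↑ʳ s) (r ↑ʳ t) ≡ + 0) → (∀ s → M (r ↑ʳ s) (r ↑ʳ s) ≡ + 1) →
  det (r ℕ.+ q) M ≡
  det r (λ i j → M (i ↑ˡ q) (j ↑ˡ q) - sumFin q (λ t → M (i ↑ˡ q) (r ↑ʳ t) * M (r ↑ʳ t) (j ↑ˡ q)))
det-schurComplement r q M off-diagonal diagonal = begin
  det (r ℕ.+ q) M   ≡⟨ det-addColumnCombinations (r ℕ.+ q) M F W sources-unmodified (λ _ _ → refl) ⟨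
  det (r ℕ.+ q) F   ≡⟨ det-blockUpperTriangular r q F lower-left-zero ⟩
  det r (λ i j → F (i ↑ˡ q) (j ↑ˡ q)) * det q (λ s t → F (r ↑ʳ s) (r ↑ʳ t))
    ≡⟨ cong₂ _*_ (det-cong r (λ i j → F-left (i ↑ˡ q) j))
                 (det-diagonal q _ (+ 1) (λ s t s≢t → F-right (r ↑ʳ s) t ⟨ trans ⟩ off-diagonal s t s≢t)
                                          (λ s → F-right (r ↑ʳ s) s ⟨ trans ⟩ diagonal s)
                  ⟨ trans ⟩ ℤP.^-zeroˡ q) ⟩
  det r (λ i j → M (i ↑ˡ q) (j ↑ˡ q) - sumFin q (λ t → M (i ↑ˡ q) (r ↑ʳ t) * M (r ↑ʳ t) (j ↑ˡ q))) * + 1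
    ≡⟨ ℤP.*-identityʳ _ ⟩
  _ ∎
  where
  weight : Fin r ⊎ Fin q → Fin r ⊎ Fin q → ℤ
  weight (inj₁ j) (inj₂ t) = - M (r ↑ʳ t) (j ↑ˡ q)
  weight _        _        = + 0
  W : Fin (r ℕ.+ q) → Fin (r ℕ.+ q) → ℤ
  W c s = weight (Fin.splitAt r c) (Fin.splitAt r s)
  F : Matrix (r ℕ.+ q)
  F i c = M i c + sumFin (r ℕ.+ q) (λ s → W c s * M i s)
  sources-unmodified : ∀ c s → W c s ≡ + 0 ⊎ (∀ u → W s u ≡ + 0)
  sources-unmodified c s with Fin.splitAt r s
  ... | inj₂ _ = inj₂ (λ _ → refl)
  ... | inj₁ _ with Fin.splitAt r c
  ...   | inj₁ _ = inj₁ refl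
  ...   | inj₂ _ = inj₁ refl
  F-right : ∀ i t → F i (r ↑ʳ t) ≡ M i (r ↑ʳ t)
  F-right i t = begin
    M i (r ↑ʳ t) + sumFin (r ℕ.+ q) (λ s → W (r ↑ʳ t) s * M i s)
      ≡⟨ cong (_+_ (M i (r ↑ʳ t))) (sumFin-zero (r ℕ.+ q) λ s →
           cong (λ z → weight z (Fin.splitAt r s) * M i s) (FinP.splitAt-↑ʳ r q t) ⟨ trans ⟩ ℤP.*-zeroˡ (M i s)) ⟩
    M i (r ↑ʳ t) + + 0
      ≡⟨ ℤP.+-identityʳ _ ⟩
    M i (r ↑ʳ t) ∎
  F-left : ∀ i j → F i (j ↑ˡ q) ≡ M i (j ↑ˡ q) - sumFin q (λ t → M i (r ↑ʳ t) * M (r ↑ʳ t) (j ↑ˡ q))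
  F-left i j = cong (_+_ (M i (j ↑ˡ q))) (begin
    sumFin (r ℕ.+ q) (λ s → W (j ↑ˡ q) s * M i s)
      ≡⟨ sumFin-↑ r q _ ⟩
    sumFin r (λ k → W (j ↑ˡ q) (k ↑ˡ q) * M i (k ↑ˡ q)) + sumFin q (λ t → W (j ↑ˡ q) (r ↑ʳ t) * M i (r ↑ʳ t))
      ≡⟨ cong₂ _+_ (sumFin-zero r λ k → cong₂ (λ x y → weight x y * M i (k ↑ˡ q)) (FinP.splitAt-↑ˡ r j q) (FinP.splitAt-↑ˡ r k q)
                                          ⟨ trans ⟩ ℤP.*-zeroˡ (M i (k ↑ˡ q)))
                   (sumFin-cong q λ t → cong₂ (λ x y → weight x y * M i (r ↑ʳ t)) (FinP.splitAt-↑ˡ r j q) (FinP.splitAt-↑ʳ r q t)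
                                          ⟨ trans ⟩ sym (ℤP.neg-distribˡ-* (M (r ↑ʳ t) (j ↑ˡ q)) (M i (r ↑ʳ t)))
                                          ⟨ trans ⟩ cong (λ z → - z) (ℤP.*-comm (M (r ↑ʳ t) (j ↑ˡ q)) (M i (r ↑ʳ t)))) ⟩
    + 0 + sumFin q (λ t → - (M i (r ↑ʳ t) * M (r ↑ʳ t) (j ↑ˡ q)))
      ≡⟨ ℤP.+-identityˡ _ ⟨ trans ⟩ sumFin-neg q _ ⟩
    - sumFin q (λ t → M i (r ↑ʳ t) * M (r ↑ʳ t) (j ↑ˡ q)) ∎)
  lower-left-zero : ∀ s j → F (r ↑ʳ s) (j ↑ˡ q) ≡ + 0
  lower-left-zero s j = begin
    F (r ↑ʳ s) (j ↑ˡ q)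
      ≡⟨ F-left (r ↑ʳ s) j ⟩
    M (r ↑ʳ s) (j ↑ˡ q) - sumFin q (λ t → M (r ↑ʳ s) (r ↑ʳ t) * M (r ↑ʳ t) (j ↑ˡ q))
      ≡⟨ cong (λ z → M (r ↑ʳ s) (j ↑ˡ q) - z) (sumFin-single q _ s (λ t t≢s →
           cong (_* M (r ↑ʳ t) (j ↑ˡ q)) (off-diagonal s t (t≢s ∘ sym)) ⟨ trans ⟩ ℤP.*-zeroˡ (M (r ↑ʳ t) (j ↑ˡ q)))) ⟩
    M (r ↑ʳ s) (j ↑ˡ q) - M (r ↑ʳ s) (r ↑ʳ s) * M (r ↑ʳ s) (j ↑ˡ q)
      ≡⟨ cong (λ z → M (r ↑ʳ s) (j ↑ˡ q) - z * M (r ↑ʳ s) (j ↑ˡ q)) (diagonal s) ⟩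
    M (r ↑ʳ s) (j ↑ˡ q) - + 1 * M (r ↑ʳ s) (j ↑ˡ q)
      ≡⟨ cong (λ z → M (r ↑ʳ s) (j ↑ˡ q) - z) (ℤP.*-identityˡ _) ⟨ trans ⟩ ℤP.+-inverseʳ (M (r ↑ʳ s) (j ↑ˡ q)) ⟩
    + 0 ∎

sign-squared : ∀ n → sign n * sign n ≡ + 1
sign-squared zero    = refl
sign-squared (suc n) = neg-squared (sign n) ⟨ trans ⟩ sign-squared n
  where
  neg-squared : ∀ s → - s * - s ≡ s * s
  neg-squared = solve-∀

-- the minor of an arrowhead matrix obtained by deleting the first row and a column other than the first
det-arrowheadMinor : ∀ m (i : Fin (suc m)) (Q : Matrix (suc m)) (c d : ℤ) →
  (∀ r → Q r fzero ≡ c) → (∀ l → Q (punchIn i l) (fsuc l) ≡ d) →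
  (∀ r l → r ≢ punchIn i l → Q r (fsuc l) ≡ + 0) → det (suc m) Q ≡ sign (toℕ i) * c * d ^ m
det-arrowheadMinor m fzero Q c d first-column diagonal off-diagonal = begin
  + 1 * Q fzero fzero * det m (minor fzero Q) + sumFin m (λ l → term Q (fsuc l))
    ≡⟨ cong₂ _+_ (cong₂ (λ x D → + 1 * x * D) (first-column fzero)
                   (det-diagonal m (minor fzero Q) d (λ r l r≢l → off-diagonal (fsuc r) l (r≢l ∘ FinP.suc-injective)) diagonal))
                 (sumFin-zero m (λ l → term-zero Q (fsuc l) (off-diagonal fzero l (λ ())))) ⟩
  + 1 * c * d ^ m + + 0
    ≡⟨ ℤP.+-identityʳ _ ⟩
  + 1 * c * d ^ m ∎
det-arrowheadMinor (suc m) (fsuc i) Q c d first-column diagonal off-diagonal = begin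
  + 1 * Q fzero fzero * det (suc m) (minor fzero Q) + (- (+ 1) * Q fzero (fsuc fzero) * det (suc m) (minor (fsuc fzero) Q)
    + sumFin m (λ l → term Q (fsuc (fsuc l))))
    ≡⟨ cong₂ _+_ (cong (+ 1 * Q fzero fzero *_) (det-zeroColumn (suc m) (minor fzero Q) fzero (λ r → off-diagonal (fsuc r) fzero (λ ()))))
         (cong₂ _+_ (cong₂ (λ x D → - (+ 1) * x * D) (diagonal fzero)
                      (det-arrowheadMinor m i (minor (fsuc fzero) Q) c d (first-column ∘ fsuc) (diagonal ∘ fsuc)
                        (λ r l r≢ → off-diagonal (fsuc r) (fsuc l) (r≢ ∘ FinP.suc-injective))))
                    (sumFin-zero m (λ l → term-zero Q (fsuc (fsuc l)) (off-diagonal fzero (fsuc l) (λ ()))))) ⟩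
  + 1 * Q fzero fzero * + 0 + (- (+ 1) * d * (sign (toℕ i) * c * d ^ m) + + 0)
    ≡⟨ rearrange (Q fzero fzero) (sign (toℕ i)) c d (d ^ m) ⟩
  - sign (toℕ i) * c * (d * d ^ m) ∎
  where
  rearrange : ∀ x s c d P → + 1 * x * + 0 + (- (+ 1) * d * (s * c * P) + + 0) ≡ - s * c * (d * P)
  rearrange = solve-∀

det-arrowhead : ∀ m (A : Matrix (suc (suc m))) (a b c d : ℤ) →
  A fzero fzero ≡ a → (∀ l → A fzero (fsuc l) ≡ b) → (∀ i → A (fsuc i) fzero ≡ c) →
  (∀ i → A (fsuc i) (fsuc i) ≡ d) → (∀ i l → i ≢ l → A (fsuc i) (fsuc l) ≡ + 0) →
  det (suc (suc m)) A ≡ (a * d - + suc m * (b * c)) * d ^ m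
det-arrowhead m A a b c d corner first-row first-column diagonal off-diagonal = begin
  + 1 * A fzero fzero * det (suc m) (minor fzero A) + sumFin (suc m) (λ l → term A (fsuc l))
    ≡⟨ cong₂ _+_ (cong₂ (λ x D → + 1 * x * D) corner (det-diagonal (suc m) (minor fzero A) d off-diagonal diagonal))
                 (sumFin-cong (suc m) edge-term ⟨ trans ⟩ sumFin-const (suc m) _) ⟩
  + 1 * a * (d * d ^ m) + + suc m * - (b * c * d ^ m)
    ≡⟨ collect a b c d (d ^ m) (+ suc m) ⟩
  (a * d - + suc m * (b * c)) * d ^ m ∎
  where
  collect : ∀ a b c d P n → + 1 * a * (d * P) + n * - (b * c * P) ≡ (a * d - n * (b * c)) * P
  collect = solve-∀
  rearrange : ∀ s b c P → - s * b * (s * c * P) ≡ - (s * s * (b * c * P))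
  rearrange = solve-∀
  edge-term : ∀ l → term A (fsuc l) ≡ - (b * c * d ^ m)
  edge-term l = begin
    - sign (toℕ l) * A fzero (fsuc l) * det (suc m) (minor (fsuc l) A)
      ≡⟨ cong₂ (λ x D → - sign (toℕ l) * x * D) (first-row l)
           (det-arrowheadMinor m l (minor (fsuc l) A) c d first-column (diagonal ∘ punchIn l)
              (λ r l′ r≢ → off-diagonal r (punchIn l l′) r≢)) ⟩
    - sign (toℕ l) * b * (sign (toℕ l) * c * d ^ m)
      ≡⟨ rearrange (sign (toℕ l)) b c (d ^ m) ⟩
    - (sign (toℕ l) * sign (toℕ l) * (b * c * d ^ m))
      ≡⟨ cong (λ z → - (z * (b * c * d ^ m))) (sign-squared (toℕ l)) ⟨ trans ⟩ cong (λ z → - z) (ℤP.*-identityˡ _) ⟩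
    - (b * c * d ^ m) ∎

-- The power hypergraph of a star

⟦_⟧ : Bool → ℤ
⟦ true  ⟧ = + 1
⟦ false ⟧ = + 0

sumℕ : ℕ → (ℕ → ℤ) → ℤ
sumℕ zero    g = + 0
sumℕ (suc N) g = g 0 + sumℕ N (g ∘ suc)

sumFin-toℕ : ∀ N (g : ℕ → ℤ) → sumFin N (g ∘ toℕ) ≡ sumℕ N g
sumFin-toℕ zero    g = refl
sumFin-toℕ (suc N) g = cong (_+_ (g 0)) (sumFin-toℕ N (g ∘ suc))

sumℕ-cong : ∀ N {f g : ℕ → ℤ} → (∀ s → s ℕ.< N → f s ≡ g s) → sumℕ N f ≡ sumℕ N g
sumℕ-cong zero    eq = refl
sumℕ-cong (suc N) eq = cong₂ _+_ (eq 0 (s≤s z≤n)) (sumℕ-cong N (λ s s<N → eq (suc s) (s≤s s<N)))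

sumℕ-zero : ∀ N {f : ℕ → ℤ} → (∀ s → s ℕ.< N → f s ≡ + 0) → sumℕ N f ≡ + 0
sumℕ-zero zero    eq = refl
sumℕ-zero (suc N) eq = cong₂ _+_ (eq 0 (s≤s z≤n)) (sumℕ-zero N (λ s s<N → eq (suc s) (s≤s s<N)))

sumℕ-single : ∀ N (f : ℕ → ℤ) t → t ℕ.< N → (∀ s → s ℕ.< N → s ≢ t → f s ≡ + 0) → sumℕ N f ≡ f t
sumℕ-single (suc N) f zero    _         off =
  cong (_+_ (f 0)) (sumℕ-zero N (λ s s<N → off (suc s) (s≤s s<N) (λ ()))) ⟨ trans ⟩ ℤP.+-identityʳ (f 0)
sumℕ-single (suc N) f (suc t) (s≤s t<N) off =
  cong₂ _+_ (off 0 (s≤s z≤n) (λ ())) (sumℕ-single N (f ∘ suc) t t<N (λ s s<N s≢t → off (suc s) (s≤s s<N) (s≢t ∘ ℕP.suc-injective)))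
  ⟨ trans ⟩ ℤP.+-identityˡ (f (suc t))

sumℕ-*ʳ : ∀ N (f : ℕ → ℤ) v → sumℕ N (λ s → f s * v) ≡ sumℕ N f * v
sumℕ-*ʳ zero    f v = sym (ℤP.*-zeroˡ v)
sumℕ-*ʳ (suc N) f v = cong (_+_ (f 0 * v)) (sumℕ-*ʳ N (f ∘ suc) v) ⟨ trans ⟩ sym (ℤP.*-distribʳ-+ v (f 0) _)

suc-≤ᵇ-suc : ∀ a b → (suc a ≤ᵇ suc b) ≡ (a ≤ᵇ b)
suc-≤ᵇ-suc zero    b = refl
suc-≤ᵇ-suc (suc a) b = refl

+-≤ᵇ-cancelˡ : ∀ a b c → (a ℕ.+ b ≤ᵇ a ℕ.+ c) ≡ (b ≤ᵇ c)
+-≤ᵇ-cancelˡ zero    b c = refl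
+-≤ᵇ-cancelˡ (suc a) b c = suc-≤ᵇ-suc (a ℕ.+ b) (a ℕ.+ c) ⟨ trans ⟩ +-≤ᵇ-cancelˡ a b c

+-<ᵇ-cancelˡ : ∀ a b c → (a ℕ.+ b <ᵇ a ℕ.+ c) ≡ (b <ᵇ c)
+-<ᵇ-cancelˡ zero    b c = refl
+-<ᵇ-cancelˡ (suc a) b c = +-<ᵇ-cancelˡ a b c

count-range : ∀ N lo hi → lo ℕ.≤ hi → hi ℕ.≤ N → sumℕ N (λ t → ⟦ (lo ≤ᵇ t) ∧ (t <ᵇ hi) ⟧) ≡ + (hi ∸ lo)
count-range zero    zero     zero     z≤n        z≤n        = refl
count-range (suc N) zero     zero     _          _          = sumℕ-zero (suc N) (λ _ _ → refl)
count-range (suc N) zero     (suc hi) _          (s≤s hi≤N) = cong (_+_ (+ 1)) (count-range N zero hi z≤n hi≤N)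
count-range (suc N) (suc lo) (suc hi) (s≤s lo≤hi) (s≤s hi≤N) =
  ℤP.+-identityˡ _ ⟨ trans ⟩
  sumℕ-cong N (λ t _ → cong (λ b → ⟦ b ∧ (t <ᵇ hi) ⟧) (suc-≤ᵇ-suc lo t)) ⟨ trans ⟩ count-range N lo hi lo≤hi hi≤N

+length-filterᵇ : ∀ {A : Set} (q : A → Bool) (xs : List A) →
  + length (filterᵇ q xs) ≡ foldr _+_ (+ 0) (map (⟦_⟧ ∘ q) xs)
+length-filterᵇ q []       = refl
+length-filterᵇ q (x ∷ xs) with q x
... | true  = cong (_+_ (+ 1)) (+length-filterᵇ q xs)
... | false = +length-filterᵇ q xs ⟨ trans ⟩ sym (ℤP.+-identityˡ _)

foldr-applyUpTo : ∀ N (g : ℕ → ℤ) → foldr _+_ (+ 0) (applyUpTo g N) ≡ sumℕ N g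
foldr-applyUpTo zero    g = refl
foldr-applyUpTo (suc N) g = cong (_+_ (g 0)) (foldr-applyUpTo N (g ∘ suc))

zip-applyUpTo : ∀ {A B : Set} (f : ℕ → A) (g : ℕ → B) N →
  zip (applyUpTo f N) (applyUpTo g N) ≡ applyUpTo (λ e → f e , g e) N
zip-applyUpTo f g zero    = refl
zip-applyUpTo f g (suc N) = cong (_ ∷_) (zip-applyUpTo (f ∘ suc) (g ∘ suc) N)

toℕ-pair : ∀ {n} → Fin n × Fin n → ℕ × ℕ
toℕ-pair = Prod.map toℕ toℕ

star-edges : ∀ m → map toℕ-pair (gedges (star (suc m))) ≡ applyUpTo (λ e → 0 , suc e) m
star-edges zero    = refl
star-edges (suc m) = cong ((0 , 1) ∷_) (
  shift _ ⟨ trans ⟩ cong (map (Prod.map₂ suc)) (star-edges m) ⟨ trans ⟩ ListP.map-applyUpTo _ _ m)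
  where
  shift : ∀ {m} (X : List (Fin m)) →
    map toℕ-pair (map (λ i → fzero {suc m} , fsuc i) (map fsuc X)) ≡
    map (Prod.map₂ suc) (map toℕ-pair (map (λ i → fzero , fsuc i) X))
  shift []      = refl
  shift (_ ∷ X) = cong (_ ∷_) (shift X)

star-size : ∀ m → length (gedges (star (suc m))) ≡ m
star-size m = sym (ListP.length-map toℕ-pair (gedges (star (suc m))))
  ⟨ trans ⟩ cong length (star-edges m) ⟨ trans ⟩ ListP.length-applyUpTo _ m

≡ᵇ-true : ∀ {a b} → a ≡ b → (a ≡ᵇ b) ≡ true
≡ᵇ-true = dec-true (_ ℕ.≟ _)

≡ᵇ-false : ∀ {a b} → a ≢ b → (a ≡ᵇ b) ≡ false
≡ᵇ-false = dec-false (_ ℕ.≟ _)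

≤ᵇ-true : ∀ {a b} → a ℕ.≤ b → (a ≤ᵇ b) ≡ true
≤ᵇ-true = dec-true (_ ℕ.≤? _)

≤ᵇ-false : ∀ {a b} → ¬ a ℕ.≤ b → (a ≤ᵇ b) ≡ false
≤ᵇ-false = dec-false (_ ℕ.≤? _)

<ᵇ-true : ∀ {a b} → a ℕ.< b → (a <ᵇ b) ≡ true
<ᵇ-true = dec-true (_ ℕ.<? _)

<ᵇ-false : ∀ {a b} → ¬ a ℕ.< b → (a <ᵇ b) ≡ false
<ᵇ-false = dec-false (_ ℕ.<? _)

-- m leaves and p = k - 2 added vertices per edge; vertex 0 is the centre, suc e the leaf of
-- edge e < m, and lo e ≤ w < lo (suc e) are the added vertices of edge e
module PowerOfStar (m p : ℕ) (x : ℤ) where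

  H : Hypergraph
  H = power (suc (suc p)) (star (suc m))

  lo : ℕ → ℕ
  lo e = suc m ℕ.+ e ℕ.* p

  N₀ : ℕ
  N₀ = lo m

  inBlock : ℕ → ℕ → Bool
  inBlock e w = (lo e ≤ᵇ w) ∧ (w <ᵇ lo (suc e))

  inEdge : ℕ → ℕ → Bool
  inEdge e w = (w ≡ᵇ 0) ∨ (w ≡ᵇ suc e) ∨ inBlock e w

  edges-incidence : ∀ (i j : Fin (V H)) →
    map (λ E → E i ∧ E j) (edges H) ≡ applyUpTo (λ e → inEdge e (toℕ i) ∧ inEdge e (toℕ j)) m
  edges-incidence i j = begin
    map (λ E → E i ∧ E j) (edges H)
      ≡⟨ sym (ListP.map-∘ _) ⟨ trans ⟩ ListP.map-cong (λ { (e , (u , v)) → refl }) _ ⟩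
    map (both ∘ Prod.map₂ toℕ-pair) (zip (upTo (length G)) G)
      ≡⟨ ListP.map-∘ _ ⟩
    map both (map (Prod.map id toℕ-pair) (zip (upTo (length G)) G))
      ≡⟨ cong (map both) (sym (ListP.zip-map id toℕ-pair (upTo (length G)) G)) ⟩
    map both (zip (map id (upTo (length G))) (map toℕ-pair G))
      ≡⟨ cong₂ (λ xs ys → map both (zip xs ys)) (ListP.map-id _ ⟨ trans ⟩ cong upTo (star-size m)) (star-edges m) ⟩
    map both (zip (upTo m) (applyUpTo (λ e → 0 , suc e) m))
      ≡⟨ cong (map both) (zip-applyUpTo id _ m) ⟨ trans ⟩ ListP.map-applyUpTo _ both m ⟩
    applyUpTo (λ e → inEdge e (toℕ i) ∧ inEdge e (toℕ j)) m ∎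
    where
    G = gedges (star (suc m))
    through : ℕ → ℕ × ℕ → ℕ → Bool
    through e (a , b) w = (w ≡ᵇ a) ∨ (w ≡ᵇ b) ∨ inBlock e w
    both : ℕ × (ℕ × ℕ) → Bool
    both (e , ab) = through e ab (toℕ i) ∧ through e ab (toℕ j)

  codegree : ℕ → ℕ → ℤ
  codegree i j = sumℕ m (λ e → ⟦ inEdge e i ∧ inEdge e j ⟧)

  +codeg≡codegree : ∀ i j → + codeg H i j ≡ codegree (toℕ i) (toℕ j)
  +codeg≡codegree i j = begin
    + length (filterᵇ (λ E → E i ∧ E j) (edges H))
      ≡⟨ +length-filterᵇ _ (edges H) ⟩
    foldr _+_ (+ 0) (map (⟦_⟧ ∘ (λ E → E i ∧ E j)) (edges H))
      ≡⟨ cong (foldr _+_ (+ 0)) (ListP.map-∘ (edges H) ⟨ trans ⟩ cong (map ⟦_⟧) (edges-incidence i j)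
                                 ⟨ trans ⟩ ListP.map-applyUpTo _ ⟦_⟧ m) ⟩
    foldr _+_ (+ 0) (applyUpTo (λ e → ⟦ inEdge e (toℕ i) ∧ inEdge e (toℕ j) ⟧) m)
      ≡⟨ foldr-applyUpTo m _ ⟩
    codegree (toℕ i) (toℕ j) ∎

  χ : ℕ → ℕ → ℤ
  χ i j = if i ≡ᵇ j then x else - codegree i j

  onFin : (ℕ → ℕ → ℤ) → Matrix N₀
  onFin A i j = A (toℕ i) (toℕ j)

  charPoly≡det-χ : charPoly (V H) (adjacency H) x ≡ det N₀ (onFin χ)
  charPoly≡det-χ = resize (cong (λ L → suc m ℕ.+ L ℕ.* p) (star-size m)) entry
    where
    entry : ∀ i j → (if does (i Fin.≟ j) then x else + 0) - adjacency H i j ≡ χ (toℕ i) (toℕ j)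
    entry i j with i Fin.≟ j
    ... | yes refl rewrite dec-true (toℕ i ℕ.≟ toℕ i) refl = ℤP.+-identityʳ x
    ... | no i≢j rewrite dec-false (toℕ i ℕ.≟ toℕ j) (i≢j ∘ FinP.toℕ-injective) =
      ℤP.+-identityˡ _ ⟨ trans ⟩ cong (λ z → - z) (+codeg≡codegree i j)
    resize : ∀ {N} → N ≡ N₀ → {M : Matrix N} → (∀ i j → M i j ≡ χ (toℕ i) (toℕ j)) →
             det N M ≡ det N₀ (onFin χ)
    resize refl = det-cong N₀

  suc-m≤lo : ∀ e → suc m ℕ.≤ lo e
  suc-m≤lo e = ℕP.m≤m+n (suc m) (e ℕ.* p)

  lo-suc≤lo : ∀ {e e′} → e ℕ.< e′ → lo (suc e) ℕ.≤ lo e′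
  lo-suc≤lo e<e′ = ℕP.+-monoʳ-≤ (suc m) (ℕP.*-monoˡ-≤ p e<e′)

  inBlock-small : ∀ e {w} → w ℕ.≤ m → inBlock e w ≡ false
  inBlock-small e {w} w≤m = cong (_∧ (w <ᵇ lo (suc e))) (≤ᵇ-false (ℕP.<⇒≱ (ℕP.<-≤-trans (s≤s w≤m) (suc-m≤lo e))))

  inBlock-added : ∀ {e w} → lo e ℕ.≤ w → w ℕ.< lo (suc e) → ∀ e′ → inBlock e′ w ≡ (e ≡ᵇ e′)
  inBlock-added {e} {w} lo≤w w<lo e′ with ℕP.<-cmp e e′
  ... | tri≈ _ refl _ = cong₂ _∧_ (≤ᵇ-true lo≤w) (<ᵇ-true w<lo) ⟨ trans ⟩ sym (≡ᵇ-true {e} refl)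
  ... | tri< e<e′ _ _ =
    cong (_∧ (w <ᵇ lo (suc e′))) (≤ᵇ-false (ℕP.<⇒≱ (ℕP.<-≤-trans w<lo (lo-suc≤lo e<e′))))
    ⟨ trans ⟩ sym (≡ᵇ-false (ℕP.<⇒≢ e<e′))
  ... | tri> _ _ e′<e =
    cong ((lo e′ ≤ᵇ w) ∧_) (<ᵇ-false (ℕP.≤⇒≯ (ℕP.≤-trans (lo-suc≤lo e′<e) lo≤w))) ⟨ trans ⟩ BoolP.∧-zeroʳ (lo e′ ≤ᵇ w)
    ⟨ trans ⟩ sym (≡ᵇ-false (ℕP.>⇒≢ e′<e))

  record UniqueEdge (e w : ℕ) : Set where
    constructor uniqueEdge
    field
      edge<m    : e ℕ.< m
      incidence : ∀ e′ → e′ ℕ.< m → inEdge e′ w ≡ (e ≡ᵇ e′)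

  uniqueEdge-leaf : ∀ {e} → e ℕ.< m → UniqueEdge e (suc e)
  uniqueEdge-leaf {e} e<m = uniqueEdge e<m λ e′ _ →
    cong ((e ≡ᵇ e′) ∨_) (inBlock-small e′ e<m) ⟨ trans ⟩ BoolP.∨-identityʳ (e ≡ᵇ e′)

  uniqueEdge-added : ∀ {e w} → e ℕ.< m → lo e ℕ.≤ w → w ℕ.< lo (suc e) → UniqueEdge e w
  uniqueEdge-added {e} {w} e<m lo≤w w<lo = uniqueEdge e<m λ e′ e′<m →
    cong₂ (λ a b → a ∨ b ∨ inBlock e′ w)
      (≡ᵇ-false {w} (ℕP.>⇒≢ (ℕP.<-≤-trans (s≤s z≤n) m<w)))
      (≡ᵇ-false {w} (ℕP.>⇒≢ (ℕP.≤-<-trans e′<m m<w)))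
    ⟨ trans ⟩ inBlock-added {e} lo≤w w<lo e′
    where
    m<w : m ℕ.< w
    m<w = ℕP.≤-trans (suc-m≤lo e) lo≤w

  codegree-comm : ∀ i j → codegree i j ≡ codegree j i
  codegree-comm i j = sumℕ-cong m (λ e _ → cong ⟦_⟧ (BoolP.∧-comm (inEdge e i) (inEdge e j)))

  codegree-unique : ∀ {e j} i → UniqueEdge e j → codegree i j ≡ ⟦ inEdge e i ⟧
  codegree-unique {e} {j} i (uniqueEdge e<m unique) = begin
    sumℕ m (λ e′ → ⟦ inEdge e′ i ∧ inEdge e′ j ⟧)
      ≡⟨ sumℕ-cong m (λ e′ e′<m → cong (λ b → ⟦ inEdge e′ i ∧ b ⟧) (unique e′ e′<m)) ⟩
    sumℕ m (λ e′ → ⟦ inEdge e′ i ∧ (e ≡ᵇ e′) ⟧)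
      ≡⟨ sumℕ-single m _ e e<m (λ e′ _ e′≢e →
           cong (λ b → ⟦ inEdge e′ i ∧ b ⟧) (≡ᵇ-false (e′≢e ∘ sym)) ⟨ trans ⟩ cong ⟦_⟧ (BoolP.∧-zeroʳ (inEdge e′ i))) ⟩
    ⟦ inEdge e i ∧ (e ≡ᵇ e) ⟧
      ≡⟨ cong (λ b → ⟦ inEdge e i ∧ b ⟧) (≡ᵇ-true {e} refl) ⟨ trans ⟩ cong ⟦_⟧ (BoolP.∧-identityʳ (inEdge e i)) ⟩
    ⟦ inEdge e i ⟧ ∎

  χ-diagonal : ∀ i → χ i i ≡ x
  χ-diagonal i = cong (if_then x else - codegree i i) (≡ᵇ-true {i} refl)

  χ-unique : ∀ {e i j} → i ≢ j → UniqueEdge e j → χ i j ≡ - ⟦ inEdge e i ⟧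
  χ-unique {i = i} {j} i≢j unique = cong (if_then x else - codegree i j) (≡ᵇ-false i≢j) ⟨ trans ⟩ cong (λ z → - z) (codegree-unique i unique)

  χ-unique′ : ∀ {e i j} → i ≢ j → UniqueEdge e i → χ i j ≡ - ⟦ inEdge e j ⟧
  χ-unique′ {i = i} {j} i≢j unique =
    cong (if_then x else - codegree i j) (≡ᵇ-false i≢j) ⟨ trans ⟩ cong (λ z → - z) (codegree-comm i j ⟨ trans ⟩ codegree-unique j unique)

  data Kind : ℕ → Set where
    centre : Kind 0
    leaf   : ∀ {e} → e ℕ.< m → Kind (suc e)
    added  : ∀ {e w} → e ℕ.< m → lo e ℕ.≤ w → w ℕ.< lo (suc e) → Kind w

  kind : ∀ w → w ℕ.< N₀ → Kind w
  kind zero    _    = centre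
  kind (suc e) w<N₀ with suc e ℕ.≤? m
  ... | yes e<m = leaf e<m
  ... | no  e≮m with block-of m (subst (ℕ._≤ suc e) (sym (ℕP.+-identityʳ (suc m))) (ℕP.≰⇒> e≮m)) w<N₀
    where
    block-of : ∀ M {w} → lo 0 ℕ.≤ w → w ℕ.< lo M → ∃[ e ] e ℕ.< M × lo e ℕ.≤ w × w ℕ.< lo (suc e)
    block-of zero    lo≤w w<lo = ⊥-elim (ℕP.<⇒≱ w<lo lo≤w)
    block-of (suc M) {w} lo≤w w<lo with w ℕ.<? lo M
    ... | yes w<loM = Prod.map₂ (Prod.map₁ ℕP.m<n⇒m<1+n) (block-of M lo≤w w<loM)
    ... | no  w≮loM = M , ℕP.n<1+n M , ℕP.≮⇒≥ w≮loM , w<lo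
  ...   | e′ , e′<m , lo≤w , w<lo = added e′<m lo≤w w<lo

  isAdded : ℕ → Bool
  isAdded w = suc m ≤ᵇ w

  isLeaf : ℕ → Bool
  isLeaf w = (0 <ᵇ w) ∧ (w ≤ᵇ m)

  -- ℓ is the leaf on the edge of the added vertex c
  leafOf : ℕ → ℕ → Bool
  leafOf ℓ c = isLeaf ℓ ∧ inBlock (ℓ ∸ 1) c

  isLeaf-large : ∀ {w} → suc m ℕ.≤ w → isLeaf w ≡ false
  isLeaf-large {w} m<w = cong ((0 <ᵇ w) ∧_) (≤ᵇ-false (ℕP.<⇒≱ m<w)) ⟨ trans ⟩ BoolP.∧-zeroʳ (0 <ᵇ w)

  leafOf-added : ∀ {e c} → e ℕ.< m → lo e ℕ.≤ c → c ℕ.< lo (suc e) → ∀ ℓ → leafOf ℓ c ≡ (ℓ ≡ᵇ suc e)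
  leafOf-added e<m lo≤c c<lo zero = refl
  leafOf-added {e} e<m lo≤c c<lo (suc ℓ) with ℓ ℕ.≟ e
  ... | yes refl = cong₂ _∧_ (≤ᵇ-true e<m) (inBlock-added {e} lo≤c c<lo e ⟨ trans ⟩ ≡ᵇ-true {e} refl)
                   ⟨ trans ⟩ sym (≡ᵇ-true {ℓ} refl)
  ... | no ℓ≢e = cong ((suc ℓ ≤ᵇ m) ∧_) (inBlock-added {e} lo≤c c<lo ℓ ⟨ trans ⟩ ≡ᵇ-false (ℓ≢e ∘ sym))
                 ⟨ trans ⟩ BoolP.∧-zeroʳ (suc ℓ ≤ᵇ m) ⟨ trans ⟩ sym (≡ᵇ-false ℓ≢e)

  inEdge-unique : ∀ {e w} → UniqueEdge e w → inEdge e w ≡ true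
  inEdge-unique {e} (uniqueEdge e<m incidence) = incidence e e<m ⟨ trans ⟩ ≡ᵇ-true {e} refl

  -- column c of the characteristic matrix after subtracting, for added c, the column of its leaf,
  -- and then pulling out the common factor x + 1
  scale : ℕ → ℤ
  scale c = if isAdded c then x + + 1 else + 1

  M₁ : ℕ → ℕ → ℤ
  M₁ i c = if isAdded c then ⟦ i ≡ᵇ c ⟧ - ⟦ leafOf i c ⟧ else χ i c

  W₁ : ℕ → ℕ → ℤ
  W₁ c s = - ⟦ isAdded c ∧ leafOf s c ⟧

  W₁-sources : ∀ c s → W₁ c s ≡ + 0 ⊎ (∀ u → W₁ s u ≡ + 0)
  W₁-sources c s with suc m ℕ.≤? s
  ... | yes m<s = inj₁ (cong (λ b → - ⟦ isAdded c ∧ (b ∧ inBlock (s ∸ 1) c) ⟧) (isLeaf-large m<s)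
                        ⟨ trans ⟩ cong (λ b → - ⟦ b ⟧) (BoolP.∧-zeroʳ (isAdded c)))
  ... | no  m≮s = inj₂ (λ u → cong (λ b → - ⟦ b ∧ leafOf u s ⟧) (≤ᵇ-false m≮s))

  scale-M₁-added : ∀ {e c} i → UniqueEdge e c → c ≢ suc e →
    (x + + 1) * (⟦ i ≡ᵇ c ⟧ - ⟦ i ≡ᵇ suc e ⟧) ≡ χ i c + - + 1 * χ i (suc e)
  scale-M₁-added {e} {c} i added-unique c≢leaf with i ℕ.≟ c | i ℕ.≟ suc e
  ... | yes refl | _ = begin
    (x + + 1) * (⟦ i ≡ᵇ i ⟧ - ⟦ i ≡ᵇ suc e ⟧)
      ≡⟨ cong₂ (λ a b → (x + + 1) * (⟦ a ⟧ - ⟦ b ⟧)) (≡ᵇ-true {i} refl) (≡ᵇ-false c≢leaf) ⟩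
    (x + + 1) * (+ 1 - + 0)
      ≡⟨ ring x ⟩
    x + - + 1 * - + 1
      ≡⟨ cong₂ (λ a b → a + - + 1 * b) (χ-diagonal i)
           (χ-unique c≢leaf leaf-unique ⟨ trans ⟩ cong (λ b → - ⟦ b ⟧) (inEdge-unique added-unique)) ⟨
    χ i i + - + 1 * χ i (suc e) ∎
    where
    ring : ∀ x → (x + + 1) * (+ 1 - + 0) ≡ x + - + 1 * - + 1
    ring = solve-∀
    leaf-unique = uniqueEdge-leaf (UniqueEdge.edge<m added-unique)
  ... | no i≢c | yes refl = begin
    (x + + 1) * (⟦ suc e ≡ᵇ c ⟧ - ⟦ suc e ≡ᵇ suc e ⟧)
      ≡⟨ cong₂ (λ a b → (x + + 1) * (⟦ a ⟧ - ⟦ b ⟧)) (≡ᵇ-false i≢c) (≡ᵇ-true {suc e} refl) ⟩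
    (x + + 1) * (+ 0 - + 1)
      ≡⟨ ring x ⟩
    - + 1 + - + 1 * x
      ≡⟨ cong₂ (λ a b → a + - + 1 * b)
           (χ-unique i≢c added-unique ⟨ trans ⟩ cong (λ b → - ⟦ b ⟧) (inEdge-unique leaf-unique))
           (χ-diagonal (suc e)) ⟨
    χ (suc e) c + - + 1 * χ (suc e) (suc e) ∎
    where
    ring : ∀ x → (x + + 1) * (+ 0 - + 1) ≡ - + 1 + - + 1 * x
    ring = solve-∀
    leaf-unique = uniqueEdge-leaf (UniqueEdge.edge<m added-unique)
  ... | no i≢c | no i≢leaf = begin
    (x + + 1) * (⟦ i ≡ᵇ c ⟧ - ⟦ i ≡ᵇ suc e ⟧)
      ≡⟨ cong₂ (λ a b → (x + + 1) * (⟦ a ⟧ - ⟦ b ⟧)) (≡ᵇ-false i≢c) (≡ᵇ-false i≢leaf) ⟩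
    (x + + 1) * (+ 0 - + 0)
      ≡⟨ ring x ⟦ inEdge e i ⟧ ⟩
    - ⟦ inEdge e i ⟧ + - + 1 * - ⟦ inEdge e i ⟧
      ≡⟨ cong₂ (λ a b → a + - + 1 * b) (χ-unique i≢c added-unique)
                                        (χ-unique i≢leaf (uniqueEdge-leaf (UniqueEdge.edge<m added-unique))) ⟨
    χ i c + - + 1 * χ i (suc e) ∎
    where
    ring : ∀ x a → (x + + 1) * (+ 0 - + 0) ≡ - a + - + 1 * - a
    ring = solve-∀

  scale-M₁-unmodified : ∀ i c → isAdded c ≡ false → scale c * M₁ i c ≡ χ i c + sumℕ N₀ (λ s → W₁ c s * χ i s)
  scale-M₁-unmodified i c not-added = begin
    scale c * M₁ i c
      ≡⟨ cong (λ b → (if b then x + + 1 else + 1) * (if b then ⟦ i ≡ᵇ c ⟧ - ⟦ leafOf i c ⟧ else χ i c)) not-added ⟩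
    + 1 * χ i c
      ≡⟨ ℤP.*-identityˡ (χ i c) ⟩
    χ i c
      ≡⟨ ℤP.+-identityʳ (χ i c) ⟨
    χ i c + + 0
      ≡⟨ cong (_+_ (χ i c)) (sumℕ-zero N₀ (λ s _ →
           cong (λ b → - ⟦ b ∧ leafOf s c ⟧ * χ i s) not-added ⟨ trans ⟩ ℤP.*-zeroˡ (χ i s))) ⟨
    χ i c + sumℕ N₀ (λ s → W₁ c s * χ i s) ∎

  scale-M₁ : ∀ i c → c ℕ.< N₀ → scale c * M₁ i c ≡ χ i c + sumℕ N₀ (λ s → W₁ c s * χ i s)
  scale-M₁ i c c<N₀ with kind c c<N₀
  ... | centre   = scale-M₁-unmodified i c refl
  ... | leaf e<m = scale-M₁-unmodified i c (≤ᵇ-false (ℕP.<⇒≱ (s≤s e<m)))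
  ... | added {e} e<m lo≤c c<lo = begin
    scale c * M₁ i c
      ≡⟨ cong (λ b → (if b then x + + 1 else + 1) * (if b then ⟦ i ≡ᵇ c ⟧ - ⟦ leafOf i c ⟧ else χ i c)) is-added ⟩
    (x + + 1) * (⟦ i ≡ᵇ c ⟧ - ⟦ leafOf i c ⟧)
      ≡⟨ cong (λ b → (x + + 1) * (⟦ i ≡ᵇ c ⟧ - ⟦ b ⟧)) (leafOf-added e<m lo≤c c<lo i) ⟩
    (x + + 1) * (⟦ i ≡ᵇ c ⟧ - ⟦ i ≡ᵇ suc e ⟧)
      ≡⟨ scale-M₁-added i (uniqueEdge-added e<m lo≤c c<lo) c≢leaf ⟩
    χ i c + - + 1 * χ i (suc e)
      ≡⟨ cong (λ w → χ i c + w * χ i (suc e)) (W₁-leaf (suc e) ⟨ trans ⟩ cong (λ b → - ⟦ b ⟧) (≡ᵇ-true {suc e} refl)) ⟨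
    χ i c + W₁ c (suc e) * χ i (suc e)
      ≡⟨ cong (_+_ (χ i c)) (sumℕ-single N₀ (λ s → W₁ c s * χ i s) (suc e) leaf<N₀ λ s _ s≢leaf →
           cong (_* χ i s) (W₁-leaf s ⟨ trans ⟩ cong (λ b → - ⟦ b ⟧) (≡ᵇ-false s≢leaf)) ⟨ trans ⟩ ℤP.*-zeroˡ (χ i s)) ⟨
    χ i c + sumℕ N₀ (λ s → W₁ c s * χ i s) ∎
    where
    is-added : isAdded c ≡ true
    is-added = ≤ᵇ-true (ℕP.≤-trans (suc-m≤lo e) lo≤c)
    W₁-leaf : ∀ s → W₁ c s ≡ - ⟦ s ≡ᵇ suc e ⟧
    W₁-leaf s = cong₂ (λ a b → - ⟦ a ∧ b ⟧) is-added (leafOf-added e<m lo≤c c<lo s)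
    leaf<N₀ : suc e ℕ.< N₀
    leaf<N₀ = ℕP.<-≤-trans (s≤s e<m) (suc-m≤lo m)
    c≢leaf : c ≢ suc e
    c≢leaf c≡ = ℕP.<⇒≱ (ℕP.<-≤-trans (s≤s e<m) (suc-m≤lo e)) (subst (lo e ℕ.≤_) c≡ lo≤c)

  ∏-scale : ∏ {N₀} (scale ∘ toℕ) ≡ (x + + 1) ^ (m ℕ.* p)
  ∏-scale = begin
    ∏ {N₀} (scale ∘ toℕ)
      ≡⟨ ∏-↑ (suc m) (m ℕ.* p) (scale ∘ toℕ) ⟩
    ∏ {suc m} (λ i → scale (toℕ (i ↑ˡ m ℕ.* p))) * ∏ {m ℕ.* p} (λ t → scale (toℕ (suc m ↑ʳ t)))
      ≡⟨ cong₂ _*_ (∏-cong {suc m} (λ i → cong scale (FinP.toℕ-↑ˡ i (m ℕ.* p)) ⟨ trans ⟩ cong (if_then x + + 1 else + 1)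
                                       (≤ᵇ-false (ℕP.<⇒≱ (FinP.toℕ<n i)))))
                   (∏-cong {m ℕ.* p} (λ t → cong (if_then x + + 1 else + 1) (≤ᵇ-true {suc m} {toℕ (suc m ↑ʳ t)} (ℕP.≤-trans (ℕP.m≤m+n (suc m) (toℕ t))
                                       (ℕP.≤-reflexive (sym (FinP.toℕ-↑ʳ (suc m) t))))))) ⟩
    ∏ {suc m} (λ _ → + 1) * ∏ {m ℕ.* p} (λ _ → x + + 1)
      ≡⟨ cong₂ _*_ (∏-const (suc m) (+ 1) ⟨ trans ⟩ ℤP.^-zeroˡ (suc m)) (∏-const (m ℕ.* p) (x + + 1)) ⟩
    + 1 * (x + + 1) ^ (m ℕ.* p)
      ≡⟨ ℤP.*-identityˡ ((x + + 1) ^ (m ℕ.* p)) ⟩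
    (x + + 1) ^ (m ℕ.* p) ∎

  det-χ-M₁ : det N₀ (onFin χ) ≡ (x + + 1) ^ (m ℕ.* p) * det N₀ (onFin M₁)
  det-χ-M₁ = begin
    det N₀ (onFin χ)
      ≡⟨ det-addColumnCombinations N₀ (onFin χ) (λ i c → scale (toℕ c) * M₁ (toℕ i) (toℕ c)) (onFin W₁)
           (λ c s → Sum.map₂ (λ unmodified u → unmodified (toℕ u)) (W₁-sources (toℕ c) (toℕ s)))
           (λ i c → scale-M₁ (toℕ i) (toℕ c) (FinP.toℕ<n c)
                    ⟨ trans ⟩ cong (_+_ (χ (toℕ i) (toℕ c))) (sym (sumFin-toℕ N₀ (λ s → W₁ (toℕ c) s * χ (toℕ i) s)))) ⟨
    det N₀ (λ i c → scale (toℕ c) * M₁ (toℕ i) (toℕ c))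
      ≡⟨ det-scaleColumns N₀ (onFin M₁) (scale ∘ toℕ) ⟩
    ∏ {N₀} (scale ∘ toℕ) * det N₀ (onFin M₁)
      ≡⟨ cong (_* det N₀ (onFin M₁)) ∏-scale ⟩
    (x + + 1) ^ (m ℕ.* p) * det N₀ (onFin M₁) ∎

  M₁-small : ∀ a {b} → b ℕ.≤ m → M₁ a b ≡ χ a b
  M₁-small a {b} b≤m = cong (if_then ⟦ a ≡ᵇ b ⟧ - ⟦ leafOf a b ⟧ else χ a b) (≤ᵇ-false (ℕP.<⇒≱ (s≤s b≤m)))

  M₁-large : ∀ a {b} → suc m ℕ.≤ b → M₁ a b ≡ ⟦ a ≡ᵇ b ⟧ - ⟦ leafOf a b ⟧
  M₁-large a {b} m<b = cong (if_then ⟦ a ≡ᵇ b ⟧ - ⟦ leafOf a b ⟧ else χ a b) (≤ᵇ-true m<b)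

  -- the Schur complement of the identity block of M₁ formed by the added vertices
  schur : ℕ → ℕ → ℤ
  schur a b = M₁ a b - sumℕ (m ℕ.* p) (λ t → M₁ a (suc m ℕ.+ t) * M₁ (suc m ℕ.+ t) b)

  det-M₁ : det N₀ (onFin M₁) ≡ det (suc m) (λ i j → schur (toℕ i) (toℕ j))
  det-M₁ = det-schurComplement (suc m) (m ℕ.* p) (onFin M₁) off-diagonal diagonal ⟨ trans ⟩ det-cong (suc m) entry
    where
    toℕ-added : ∀ t → toℕ (suc m ↑ʳ t) ≡ suc m ℕ.+ toℕ t
    toℕ-added = FinP.toℕ-↑ʳ (suc m)
    large : ∀ t → suc m ℕ.≤ toℕ (suc m ↑ʳ t)
    large t = ℕP.≤-trans (ℕP.m≤m+n (suc m) (toℕ t)) (ℕP.≤-reflexive (sym (toℕ-added t)))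
    added-block : ∀ s t → onFin M₁ (suc m ↑ʳ s) (suc m ↑ʳ t) ≡ ⟦ toℕ (suc m ↑ʳ s) ≡ᵇ toℕ (suc m ↑ʳ t) ⟧
    added-block s t = M₁-large a (large t) ⟨ trans ⟩
      cong (λ l → ⟦ a ≡ᵇ b ⟧ - ⟦ l ∧ inBlock (a ∸ 1) b ⟧) (isLeaf-large (large s)) ⟨ trans ⟩ ℤP.+-identityʳ ⟦ a ≡ᵇ b ⟧
      where
      a = toℕ (suc m ↑ʳ s)
      b = toℕ (suc m ↑ʳ t)
    off-diagonal : ∀ s t → s ≢ t → onFin M₁ (suc m ↑ʳ s) (suc m ↑ʳ t) ≡ + 0
    off-diagonal s t s≢t = added-block s t ⟨ trans ⟩
      cong ⟦_⟧ (≡ᵇ-false (s≢t ∘ FinP.↑ʳ-injective (suc m) s t ∘ FinP.toℕ-injective))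
    diagonal : ∀ s → onFin M₁ (suc m ↑ʳ s) (suc m ↑ʳ s) ≡ + 1
    diagonal s = added-block s s ⟨ trans ⟩ cong ⟦_⟧ (≡ᵇ-true {toℕ (suc m ↑ʳ s)} refl)
    entry : ∀ i j → onFin M₁ (i ↑ˡ m ℕ.* p) (j ↑ˡ m ℕ.* p)
                    - sumFin (m ℕ.* p) (λ t → onFin M₁ (i ↑ˡ m ℕ.* p) (suc m ↑ʳ t) * onFin M₁ (suc m ↑ʳ t) (j ↑ˡ m ℕ.* p))
                  ≡ schur (toℕ i) (toℕ j)
    entry i j = cong₂ (λ a b → M₁ a b - sumFin (m ℕ.* p) (λ t → M₁ a (toℕ (suc m ↑ʳ t)) * M₁ (toℕ (suc m ↑ʳ t)) b))
                      (FinP.toℕ-↑ˡ i _) (FinP.toℕ-↑ˡ j _)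
      ⟨ trans ⟩ cong (λ z → M₁ (toℕ i) (toℕ j) - z)
                  (sumFin-cong (m ℕ.* p) (λ t → cong (λ w → M₁ (toℕ i) w * M₁ w (toℕ j)) (toℕ-added t))
                   ⟨ trans ⟩ sumFin-toℕ (m ℕ.* p) (λ t → M₁ (toℕ i) (suc m ℕ.+ t) * M₁ (suc m ℕ.+ t) (toℕ j)))

  block-size : ∀ {e} → e ℕ.< m → sumℕ (m ℕ.* p) (λ t → ⟦ inBlock e (suc m ℕ.+ t) ⟧) ≡ + p
  block-size {e} e<m = begin
    sumℕ (m ℕ.* p) (λ t → ⟦ inBlock e (suc m ℕ.+ t) ⟧)
      ≡⟨ sumℕ-cong (m ℕ.* p) (λ t _ → cong ⟦_⟧ (cong₂ _∧_ (+-≤ᵇ-cancelˡ (suc m) (e ℕ.* p) t)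
                                                            (+-<ᵇ-cancelˡ (suc m) t (suc e ℕ.* p)))) ⟩
    sumℕ (m ℕ.* p) (λ t → ⟦ (e ℕ.* p ≤ᵇ t) ∧ (t <ᵇ suc e ℕ.* p) ⟧)
      ≡⟨ count-range (m ℕ.* p) (e ℕ.* p) (suc e ℕ.* p) (ℕP.m≤n+m (e ℕ.* p) p) (ℕP.*-monoˡ-≤ p e<m) ⟩
    + (p ℕ.+ e ℕ.* p ∸ e ℕ.* p)
      ≡⟨ cong +_ (ℕP.m+n∸n≡m p (e ℕ.* p)) ⟩
    + p ∎

  M₁-smallRow : ∀ {a w} → a ℕ.≤ m → suc m ℕ.≤ w → M₁ a w ≡ - ⟦ leafOf a w ⟧
  M₁-smallRow {a} {w} a≤m m<w =
    M₁-large a m<w ⟨ trans ⟩ cong (λ b → ⟦ b ⟧ - ⟦ leafOf a w ⟧) (≡ᵇ-false (ℕP.<⇒≢ (ℕP.<-≤-trans (s≤s a≤m) m<w)))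
    ⟨ trans ⟩ ℤP.+-identityˡ (- ⟦ leafOf a w ⟧)

  schur-centre : ∀ {b} → b ℕ.≤ m → schur 0 b ≡ χ 0 b
  schur-centre {b} b≤m = begin
    M₁ 0 b - sumℕ (m ℕ.* p) (λ t → M₁ 0 (suc m ℕ.+ t) * M₁ (suc m ℕ.+ t) b)
      ≡⟨ cong₂ _-_ (M₁-small 0 b≤m) (sumℕ-zero (m ℕ.* p) (λ t _ →
           cong (_* M₁ (suc m ℕ.+ t) b) (M₁-smallRow z≤n (ℕP.m≤m+n (suc m) t)) ⟨ trans ⟩ ℤP.*-zeroˡ (M₁ (suc m ℕ.+ t) b))) ⟩
    χ 0 b - + 0
      ≡⟨ ℤP.+-identityʳ (χ 0 b) ⟩
    χ 0 b ∎

  schur-leaf : ∀ {e b} → e ℕ.< m → b ℕ.≤ m → schur (suc e) b ≡ χ (suc e) b - + p * ⟦ inEdge e b ⟧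
  schur-leaf {e} {b} e<m b≤m = cong₂ _-_ (M₁-small (suc e) b≤m) (begin
    sumℕ (m ℕ.* p) (λ t → M₁ (suc e) (suc m ℕ.+ t) * M₁ (suc m ℕ.+ t) b)
      ≡⟨ sumℕ-cong (m ℕ.* p) summand ⟩
    sumℕ (m ℕ.* p) (λ t → ⟦ inBlock e (suc m ℕ.+ t) ⟧ * ⟦ inEdge e b ⟧)
      ≡⟨ sumℕ-*ʳ (m ℕ.* p) (λ t → ⟦ inBlock e (suc m ℕ.+ t) ⟧) ⟦ inEdge e b ⟧ ⟩
    sumℕ (m ℕ.* p) (λ t → ⟦ inBlock e (suc m ℕ.+ t) ⟧) * ⟦ inEdge e b ⟧
      ≡⟨ cong (_* ⟦ inEdge e b ⟧) (block-size e<m) ⟩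
    + p * ⟦ inEdge e b ⟧ ∎)
    where
    indicator : ∀ c y a → (c ≡ true → y ≡ - a) → - ⟦ c ⟧ * y ≡ ⟦ c ⟧ * a
    indicator true  y a y≡-a = cong (- + 1 *_) (y≡-a refl) ⟨ trans ⟩ ℤP.-1*i≡-i (- a) ⟨ trans ⟩ ℤP.neg-involutive a
                               ⟨ trans ⟩ sym (ℤP.*-identityˡ a)
    indicator false y a _    = ℤP.*-zeroˡ y ⟨ trans ⟩ sym (ℤP.*-zeroˡ a)
    summand : ∀ t → t ℕ.< m ℕ.* p →
      M₁ (suc e) (suc m ℕ.+ t) * M₁ (suc m ℕ.+ t) b ≡ ⟦ inBlock e (suc m ℕ.+ t) ⟧ * ⟦ inEdge e b ⟧
    summand t t<mp with kind (suc m ℕ.+ t) (ℕP.+-monoʳ-< (suc m) t<mp)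
    ... | leaf e′<m = ⊥-elim (ℕP.m+n≮m m t e′<m)
    ... | added {e′} e′<m lo≤w w<lo =
      cong₂ _*_ (M₁-smallRow e<m m<w ⟨ trans ⟩ cong (λ c → - ⟦ c ∧ inBlock e w ⟧) (≤ᵇ-true e<m)) (M₁-small w b≤m)
      ⟨ trans ⟩ indicator (inBlock e w) (χ w b) ⟦ inEdge e b ⟧ in-block
      where
      w = suc m ℕ.+ t
      m<w : suc m ℕ.≤ w
      m<w = ℕP.m≤m+n (suc m) t
      in-block : inBlock e w ≡ true → χ w b ≡ - ⟦ inEdge e b ⟧
      in-block e-block with e′ ℕ.≟ e
      ... | yes refl = χ-unique′ (ℕP.>⇒≢ (ℕP.≤-<-trans b≤m m<w)) (uniqueEdge-added e′<m lo≤w w<lo)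
      ... | no e′≢e with () ← sym e-block ⟨ trans ⟩ inBlock-added {e′} lo≤w w<lo e ⟨ trans ⟩ ≡ᵇ-false e′≢e

  schur-corner : schur 0 0 ≡ x
  schur-corner = schur-centre z≤n ⟨ trans ⟩ χ-diagonal 0

  schur-firstRow : ∀ {l} → l ℕ.< m → schur 0 (suc l) ≡ - + 1
  schur-firstRow l<m = schur-centre l<m ⟨ trans ⟩ χ-unique {i = 0} (λ ()) (uniqueEdge-leaf l<m)

  schur-firstColumn : ∀ {e} → e ℕ.< m → schur (suc e) 0 ≡ - + 1 - + p
  schur-firstColumn e<m = schur-leaf e<m z≤n ⟨ trans ⟩
    cong₂ _-_ (χ-unique′ {j = 0} (λ ()) (uniqueEdge-leaf e<m)) (ℤP.*-identityʳ (+ p))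

  schur-diagonal : ∀ {e} → e ℕ.< m → schur (suc e) (suc e) ≡ x - + p
  schur-diagonal {e} e<m = schur-leaf e<m e<m ⟨ trans ⟩
    cong₂ _-_ (χ-diagonal (suc e))
              (cong (λ c → + p * ⟦ c ⟧) (inEdge-unique (uniqueEdge-leaf e<m)) ⟨ trans ⟩ ℤP.*-identityʳ (+ p))

  schur-offDiagonal : ∀ {e l} → e ℕ.< m → l ℕ.< m → e ≢ l → schur (suc e) (suc l) ≡ + 0
  schur-offDiagonal {e} {l} e<m l<m e≢l = schur-leaf e<m l<m ⟨ trans ⟩
    cong₂ _-_ (χ-unique′ (e≢l ∘ ℕP.suc-injective) (uniqueEdge-leaf e<m) ⟨ trans ⟩ cong (λ c → - ⟦ c ⟧) not-incident)
              (cong (λ c → + p * ⟦ c ⟧) not-incident ⟨ trans ⟩ ℤP.*-zeroʳ (+ p))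
    where
    not-incident : inEdge e (suc l) ≡ false
    not-incident = UniqueEdge.incidence (uniqueEdge-leaf l<m) e e<m ⟨ trans ⟩ ≡ᵇ-false (e≢l ∘ sym)

  det-χ≡schur : det N₀ (onFin χ) ≡ (x + + 1) ^ (m ℕ.* p) * det (suc m) (λ i j → schur (toℕ i) (toℕ j))
  det-χ≡schur = det-χ-M₁ ⟨ trans ⟩ cong ((x + + 1) ^ (m ℕ.* p) *_) det-M₁

theorem2 : (n k : ℕ) → 2 ≤ n → 2 ≤ k → (x : ℤ) →
    charPoly (V (power k (star n))) (adjacency (power k (star n))) x
      ≡ ((x + + 1) ^ ((n ∸ 1) Data.Nat.* (k ∸ 2)))
        * ((x - + (k ∸ 2)) ^ (n ∸ 2))
        * (x * x - + (k ∸ 2) * x - + ((n ∸ 1) Data.Nat.* (k ∸ 1)))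
theorem2 (suc zero)     _              (s≤s ()) _        x
theorem2 (suc (suc m₀)) (suc zero)     _        (s≤s ()) x
theorem2 (suc (suc m₀)) (suc (suc p)) _ _ x = begin
  charPoly (V H) (adjacency H) x
    ≡⟨ charPoly≡det-χ ⟩
  det N₀ (onFin χ)
    ≡⟨ det-χ≡schur ⟩
  (x + + 1) ^ (suc m₀ ℕ.* p) * det (suc (suc m₀)) S
    ≡⟨ cong ((x + + 1) ^ (suc m₀ ℕ.* p) *_)
         (det-arrowhead m₀ S x (- + 1) (- + 1 - + p) (x - + p) schur-corner
            (schur-firstRow ∘ FinP.toℕ<n) (schur-firstColumn ∘ FinP.toℕ<n) (schur-diagonal ∘ FinP.toℕ<n)
            (λ i l i≢l → schur-offDiagonal (FinP.toℕ<n i) (FinP.toℕ<n l) (i≢l ∘ FinP.toℕ-injective))) ⟩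
  (x + + 1) ^ (suc m₀ ℕ.* p) * ((x * (x - + p) - + suc m₀ * (- + 1 * (- + 1 - + p))) * (x - + p) ^ m₀)
    ≡⟨ collect ((x + + 1) ^ (suc m₀ ℕ.* p)) ((x - + p) ^ m₀) x (+ p) (+ suc m₀)
       ⟨ trans ⟩ cong (λ z → (x + + 1) ^ (suc m₀ ℕ.* p) * (x - + p) ^ m₀ * (x * x - + p * x - z))
                      (sym (ℤP.pos-* (suc m₀) (suc p))) ⟩
  (x + + 1) ^ (suc m₀ ℕ.* p) * (x - + p) ^ m₀ * (x * x - + p * x - + (suc m₀ ℕ.* suc p)) ∎
  where
  open PowerOfStar (suc m₀) p x
  S = λ i j → schur (toℕ i) (toℕ j)
  collect : ∀ X D x P M → X * ((x * (x - P) - M * (- + 1 * (- + 1 - P))) * D) ≡ X * D * (x * x - P * x - M * (+ 1 + P))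
  collect = solve-∀
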